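{- Let $p$ be a prime and $s\ge 0$ an integer. Define $$f(x)=\prod_{j=0}^{\beta(s)-1}(x-j),\qquad g(x)=p^s+\prod_{i=0}^{p-1}(x-i)^{s+1}.$$ Then $v(\gcd(f(n),g(n)))=s$ for all integers $n$, and the resultant $r$ of $f$ and $g$ satisfies $v(r)=s\beta(s)$.
   Context: For a nonzero integer $a$, $v(a)$ is the exponent of $p$ in $a$. Define $\alpha(j)=v(j!)=\sum_{i\ge1}\lfloor j/p^i\rfloor$ for integers $j\ge 0$ and $\beta(m)=\min\{j\ge0:\alpha(j)\ge m\}$ for integers $m\ge0$. The resultant is the determinant of the Sylvester matrix, equivalently $\prod_{i,j}(\gamma_i-\delta_j)$ over the roots of $f$ and $g$. -}

module Defs where

open import Data.Nat as ℕ using (ℕ; zero; suc; _≤_; _<_; NonZero)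
open import Data.Nat.Properties using (m^n≢0)
open import Data.Integer as ℤ using (ℤ; +_; -_)
open import Data.Integer.Divisibility using (_∣_)
open import Data.Fin using (Fin; toℕ; punchIn)
import Data.Fin as Fin
open import Data.List using (List; []; _∷_; length; foldr; upTo; map)
open import Data.Bool using (if_then_else_)
open import Data.Product using (_×_)
open import Relation.Nullary using (¬_)

-- p-adic valuation: v(a) = k  (for a nonzero integer a)
-- "k is the exponent of p in a":  p^k ∣ a  and  p^(k+1) ∤ a.
-- (This forces a ≠ 0, since 0 is divisible by every power.)

IsVal : ℕ → ℤ → ℕ → Set
IsVal p a k = (+ (p ℕ.^ k)) ∣ a × ¬ ((+ (p ℕ.^ suc k)) ∣ a)

-- α(j) = Σ_{i ≥ 1} ⌊ j / p^i ⌋.  For p ≥ 2 every term with i > j is 0,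
-- so the sum is taken over 1 ≤ i ≤ j.

α : (p : ℕ) → .{{NonZero p}} → ℕ → ℕ
α p j = foldr ℕ._+_ 0 (map term (upTo j))
  where
  term : ℕ → ℕ
  term i = ℕ._/_ j (p ℕ.^ suc i) {{m^n≢0 p (suc i)}}

-- β(m) = min { j ≥ 0 : α(j) ≥ m }, as a specification: b is that minimum.
IsBeta : (p : ℕ) → .{{NonZero p}} → ℕ → ℕ → Set
IsBeta p m b = m ≤ α p b × (∀ j → j < b → ¬ (m ≤ α p j))

-- Integer polynomials as coefficient lists, lowest degree first.

Poly : Set
Poly = List ℤ

_⊕_ : Poly → Poly → Poly
[]       ⊕ q        = q
(a ∷ p)  ⊕ []       = a ∷ p
(a ∷ p)  ⊕ (b ∷ q)  = (a ℤ.+ b) ∷ (p ⊕ q)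

scale : ℤ → Poly → Poly
scale c = map (c ℤ.*_)

_⊗_ : Poly → Poly → Poly
[]      ⊗ q = []
(a ∷ p) ⊗ q = scale a q ⊕ (+ 0 ∷ (p ⊗ q))

constP : ℤ → Poly
constP c = c ∷ []

linP : ℤ → Poly
linP c = (- c) ∷ (+ 1) ∷ []

powP : Poly → ℕ → Poly
powP q zero    = constP (+ 1)
powP q (suc k) = q ⊗ powP q k

prodP : ℕ → (ℕ → Poly) → Poly
prodP n q = foldr (λ j acc → q j ⊗ acc) (constP (+ 1)) (upTo n)

eval : Poly → ℤ → ℤ
eval []      x = + 0
eval (a ∷ p) x = a ℤ.+ x ℤ.* eval p x

coeff : Poly → ℕ → ℤ
coeff []      k       = + 0
coeff (a ∷ p) zero    = a
coeff (a ∷ p) (suc k) = coeff p k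

-- degree of a polynomial given by a list without trailing zeros
deg : Poly → ℕ
deg q = length q ℕ.∸ 1

sgn : ℕ → ℤ
sgn zero    = + 1
sgn (suc k) = - sgn k

det : (n : ℕ) → (Fin n → Fin n → ℤ) → ℤ
det zero    M = + 1
det (suc n) M = foldr ℤ._+_ (+ 0) (Data.List.map term (Data.List.allFin (suc n)))
  where
  open import Data.List using (allFin)
  term : Fin (suc n) → ℤ
  term j = sgn (toℕ j) ℤ.* M Fin.zero j ℤ.* det n (λ a b → M (Fin.suc a) (punchIn j b))

-- Sylvester matrix of f (degree m) and g (degree n): size (n+m)×(n+m).
-- Row i < n     : coefficients a_m,…,a_0 of f shifted right by i.
-- Row n + i     : coefficients b_n,…,b_0 of g shifted right by i.

sylEntry : (f g : Poly) → ℕ → ℕ → ℕ → ℕ → ℤ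
sylEntry f g m n r c =
  if r ℕ.<ᵇ n
  then (if (r ℕ.≤ᵇ c) Data.Bool.∧ ((c ℕ.∸ r) ℕ.≤ᵇ m) then coeff f (m ℕ.∸ (c ℕ.∸ r)) else + 0)
  else (if ((r ℕ.∸ n) ℕ.≤ᵇ c) Data.Bool.∧ ((c ℕ.∸ (r ℕ.∸ n)) ℕ.≤ᵇ n) then coeff g (n ℕ.∸ (c ℕ.∸ (r ℕ.∸ n))) else + 0)

sylvester : (f g : Poly) → Fin (deg g ℕ.+ deg f) → Fin (deg g ℕ.+ deg f) → ℤ
sylvester f g r c = sylEntry f g (deg f) (deg g) (toℕ r) (toℕ c)

resultant : Poly → Poly → ℤ
resultant f g = det (deg g ℕ.+ deg f) (sylvester f g)

-- The polynomials of the theorem (b = β(s) supplied via IsBeta).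

fPoly : ℕ → Poly
fPoly b = prodP b (λ j → linP (+ j))

gPoly : ℕ → ℕ → Poly
gPoly p s = constP (+ (p ℕ.^ s)) ⊕ prodP p (λ i → powP (linP (+ i)) (suc s))

module Submission where

-- The falling factorial x(x-1)⋯(x-k+1) is divisible by k! at every integer.
-- With k = p this makes ∏_{i<p}(n-i)^(s+1) a multiple of p^(s+1), so
-- g(n) = p^s (1 + p w) has valuation exactly s.  With k = b, Legendre's bound
-- p^α(b) ∣ b! and s ≤ α(b) give p^s ∣ f(n); hence v(gcd(f(n), g(n))) = s.
-- For the resultant we prove res(∏_i (x - c_i), g) = ∏_i g(c_i) on the
-- Sylvester matrix itself: adjacent row operations followed by a Horner column
-- sweep split off one linear factor (x - c) at the price of a factor g(c).
-- Thus res(f, g) = g(0)⋯g(b-1), a product of b numbers p^s (1 + p w), of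
-- valuation s·b.

open import Defs

module Determinant where

  open import Data.Nat as ℕ using (ℕ; zero; suc; z≤n; s≤s)
  import Data.Nat.Properties as ℕP
  open import Data.Integer as ℤ using (ℤ; +_; _+_; _*_; -_; _-_)
  import Data.Integer.Properties as ℤP
  open import Data.Integer.Tactic.RingSolver
  open import Relation.Binary.PropositionalEquality
  open import Relation.Nullary using (yes; no)
  open import Data.Empty using (⊥-elim)
  open import Data.Sum using (_⊎_; inj₁; inj₂)
  open import Data.Product using (Σ-syntax; _×_; _,_)
  open import Data.Fin as Fin using (Fin; toℕ)
  open import Data.List using (foldr; map; tabulate)
  open import Function using (_∘_)

  sum< : ℕ → (ℕ → ℤ) → ℤ
  sum< zero f = + 0
  sum< (suc n) f = f 0 + sum< n (λ i → f (suc i))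

  sum-cong : ∀ n {f g : ℕ → ℤ} → (∀ i → i ℕ.< n → f i ≡ g i) → sum< n f ≡ sum< n g
  sum-cong zero h = refl
  sum-cong (suc n) h = cong₂ _+_ (h 0 (s≤s z≤n)) (sum-cong n (λ i i<n → h (suc i) (s≤s i<n)))

  sum-+ : ∀ n (f g : ℕ → ℤ) → sum< n (λ i → f i + g i) ≡ sum< n f + sum< n g
  sum-+ zero f g = refl
  sum-+ (suc n) f g = trans (cong (_+_ ((f 0 + g 0))) (sum-+ n _ _)) (byRing (f 0) (g 0) (sum< n _) (sum< n _))
    where
    byRing : ∀ a b c d → a + b + (c + d) ≡ a + c + (b + d)
    byRing = solve-∀

  sum-* : ∀ n k (f : ℕ → ℤ) → sum< n (λ i → k * f i) ≡ k * sum< n f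
  sum-* zero k f = sym (ℤP.*-zeroʳ k)
  sum-* (suc n) k f = trans (cong (_+_ (k * f 0)) (sum-* n k _)) (sym (ℤP.*-distribˡ-+ k (f 0) _))

  sum-zero : ∀ n (f : ℕ → ℤ) → (∀ i → i ℕ.< n → f i ≡ + 0) → sum< n f ≡ + 0
  sum-zero n f h = trans (sum-cong n h) (z n)
    where
    z : ∀ n → sum< n (λ _ → + 0) ≡ + 0
    z zero = refl
    z (suc n) = trans (ℤP.+-identityˡ _) (z n)

  sum-last : ∀ n (f : ℕ → ℤ) → sum< (suc n) f ≡ sum< n f + f n
  sum-last zero f = trans (ℤP.+-identityʳ (f 0)) (sym (ℤP.+-identityˡ (f 0)))
  sum-last (suc n) f = trans (cong (_+_ (f 0)) (sum-last n (λ i → f (suc i)))) (sym (ℤP.+-assoc (f 0) _ _))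

  sum-swap : ∀ n m (f : ℕ → ℕ → ℤ) → sum< n (λ i → sum< m (λ j → f i j)) ≡ sum< m (λ j → sum< n (λ i → f i j))
  sum-swap zero m f = sym (sum-zero m _ (λ _ _ → refl))
  sum-swap (suc n) m f = begin
      sum< m (λ j → f 0 j) + sum< n (λ i → sum< m (λ j → f (suc i) j))
    ≡⟨ cong (_+_ (sum< m (λ j → f 0 j))) (sum-swap n m (λ i → f (suc i))) ⟩
      sum< m (λ j → f 0 j) + sum< m (λ j → sum< n (λ i → f (suc i) j))
    ≡⟨ sym (sum-+ m _ _) ⟩
      sum< m (λ j → f 0 j + sum< n (λ i → f (suc i) j))
    ∎
    where open ≡-Reasoning

  sum-adjacentPair : ∀ n c (f : ℕ → ℤ) → suc c ℕ.< n →
    (∀ i → i ℕ.< n → i ≢ c → i ≢ suc c → f i ≡ + 0) → f c + f (suc c) ≡ + 0 → sum< n f ≡ + 0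
  sum-adjacentPair (suc (suc n)) zero f lt h hp =
    trans (sym (ℤP.+-assoc (f 0) (f 1) _))
      (cong₂ _+_ hp (sum-zero n _ (λ i i<n → h (suc (suc i)) (s≤s (s≤s i<n)) (λ ()) (λ ()))))
  sum-adjacentPair (suc n) (suc c) f (s≤s lt) h hp =
    cong₂ _+_ (h 0 (s≤s z≤n) (λ ()) (λ ()))
      (sum-adjacentPair n c (λ i → f (suc i)) lt (λ i i<n i≢c i≢sc → h (suc i) (s≤s i<n) (i≢c ∘ ℕP.suc-injective) (i≢sc ∘ ℕP.suc-injective)) hp)

  -- punchIn j b is the b-th number different from j (Fin.punchIn on ℕ);
  -- the minors of the Laplace expansion are indexed through it.
  punchIn : ℕ → ℕ → ℕ
  punchIn zero b = suc b
  punchIn (suc j) zero = zero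
  punchIn (suc j) (suc b) = suc (punchIn j b)

  -- punchOut i j is the position of j ≠ i once i is removed: the inverse of punchIn i.
  punchOut : ℕ → ℕ → ℕ
  punchOut zero zero = zero
  punchOut zero (suc j) = j
  punchOut (suc i) zero = zero
  punchOut (suc i) (suc j) = suc (punchOut i j)

  punchIn≤ : ∀ j b → punchIn j b ℕ.≤ suc b
  punchIn≤ zero b = ℕP.≤-refl
  punchIn≤ (suc j) zero = z≤n
  punchIn≤ (suc j) (suc b) = s≤s (punchIn≤ j b)

  punchIn< : ∀ n j b → b ℕ.< n → punchIn j b ℕ.< suc n
  punchIn< n j b b<n = s≤s (ℕP.≤-trans (punchIn≤ j b) b<n)

  punchIn≢ : ∀ j b → punchIn j b ≢ j
  punchIn≢ zero b ()
  punchIn≢ (suc j) zero ()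
  punchIn≢ (suc j) (suc b) e = punchIn≢ j b (ℕP.suc-injective e)

  punchIn-injective : ∀ j b c → punchIn j b ≡ punchIn j c → b ≡ c
  punchIn-injective zero b c e = ℕP.suc-injective e
  punchIn-injective (suc j) zero zero e = refl
  punchIn-injective (suc j) (suc b) (suc c) e = cong suc (punchIn-injective j b c (ℕP.suc-injective e))

  punchIn-punchOut : ∀ i j → i ≢ j → punchIn i (punchOut i j) ≡ j
  punchIn-punchOut zero zero ne = ⊥-elim (ne refl)
  punchIn-punchOut zero (suc j) ne = refl
  punchIn-punchOut (suc i) zero ne = refl
  punchIn-punchOut (suc i) (suc j) ne = cong suc (punchIn-punchOut i j (ne ∘ cong suc))

  punchOut< : ∀ n i j → i ℕ.< suc n → j ℕ.< suc n → i ≢ j → punchOut i j ℕ.< n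
  punchOut< n zero zero _ _ ne = ⊥-elim (ne refl)
  punchOut< n zero (suc j) _ (s≤s j<) _ = j<
  punchOut< (suc n) (suc i) zero _ _ _ = s≤s z≤n
  punchOut< zero (suc i) zero (s≤s ()) _ _
  punchOut< (suc n) (suc i) (suc j) (s≤s i<) (s≤s j<) ne = s≤s (punchOut< n i j i< j< (ne ∘ cong suc))
  punchOut< zero (suc i) (suc j) (s≤s ()) _ _

  punchIn-last : ∀ n j → j ℕ.≤ n → punchIn j n ≡ suc n
  punchIn-last n zero _ = refl
  punchIn-last (suc n) (suc j) (s≤s j≤n) = cong suc (punchIn-last n j j≤n)

  punchIn-adjacent : ∀ c b → punchIn c b ≡ punchIn (suc c) b ⊎ (punchIn c b ≡ suc c × punchIn (suc c) b ≡ c)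
  punchIn-adjacent zero zero = inj₂ (refl , refl)
  punchIn-adjacent zero (suc b) = inj₁ refl
  punchIn-adjacent (suc c) zero = inj₁ refl
  punchIn-adjacent (suc c) (suc b) with punchIn-adjacent c b
  ... | inj₁ e = inj₁ (cong suc e)
  ... | inj₂ (e1 , e2) = inj₂ (cong suc e1 , cong suc e2)

  adjacentPair-punchIn : ∀ n i c → i ℕ.< suc n → suc c ℕ.< suc n → i ≢ c → i ≢ suc c →
    Σ[ c' ∈ ℕ ] (suc c' ℕ.< n × punchIn i c' ≡ c × punchIn i (suc c') ≡ suc c)
  adjacentPair-punchIn n zero zero _ _ ne _ = ⊥-elim (ne refl)
  adjacentPair-punchIn n zero (suc c) _ (s≤s sc<) _ _ = c , sc< , refl , refl
  adjacentPair-punchIn n (suc zero) zero _ _ _ ne = ⊥-elim (ne refl)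
  adjacentPair-punchIn (suc (suc n)) (suc (suc i)) zero _ _ _ _ = zero , s≤s (s≤s z≤n) , refl , refl
  adjacentPair-punchIn (suc zero) (suc (suc i)) zero (s≤s (s≤s ())) _ _ _
  adjacentPair-punchIn zero (suc (suc i)) zero (s≤s ()) _ _ _
  adjacentPair-punchIn (suc n) (suc i) (suc c) (s≤s i<) (s≤s sc<) ne1 ne2
    with adjacentPair-punchIn n i c i< sc< (ne1 ∘ cong suc) (ne2 ∘ cong suc)
  ... | c' , lt , e1 , e2 = suc c' , s≤s lt , cong suc e1 , cong suc e2
  adjacentPair-punchIn zero (suc i) (suc c) (s≤s ()) _ _ _

  -- Square matrices are represented by their entries on ℕ × ℕ; only the top-left
  -- n × n block matters for a determinant of size n.
  Matrix : Set
  Matrix = ℕ → ℕ → ℤ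

  det′ : ℕ → Matrix → ℤ
  det′ zero E = + 1
  det′ (suc n) E = sum< (suc n) (λ j → sgn j * E 0 j * det′ n (λ a b → E (suc a) (punchIn j b)))

  det′-cong : ∀ n (E E' : Matrix) → (∀ a b → a ℕ.< n → b ℕ.< n → E a b ≡ E' a b) → det′ n E ≡ det′ n E'
  det′-cong zero E E' h = refl
  det′-cong (suc n) E E' h = sum-cong (suc n) λ j j< →
    cong₂ _*_ (cong (sgn j *_) (h 0 j (s≤s z≤n) j<))
      (det′-cong n _ _ (λ a b a< b< → h (suc a) (punchIn j b) (s≤s a<) (punchIn< n j b b<)))

  sumFin : ∀ n → (Fin n → ℤ) → ℤ
  sumFin zero t = + 0
  sumFin (suc n) t = t Fin.zero + sumFin n (t ∘ Fin.suc)

  foldr-tabulate : ∀ n {m} (f : Fin n → Fin m) (t : Fin m → ℤ) →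
    foldr _+_ (+ 0) (map t (tabulate f)) ≡ sumFin n (t ∘ f)
  foldr-tabulate zero f t = refl
  foldr-tabulate (suc n) f t = cong (_+_ (t (f Fin.zero))) (foldr-tabulate n (f ∘ Fin.suc) t)

  sumFin-toℕ : ∀ n (u : ℕ → ℤ) → sumFin n (u ∘ toℕ) ≡ sum< n u
  sumFin-toℕ zero u = refl
  sumFin-toℕ (suc n) u = cong (_+_ (u 0)) (sumFin-toℕ n (λ i → u (suc i)))

  sumFin-cong : ∀ n {t u : Fin n → ℤ} → (∀ i → t i ≡ u i) → sumFin n t ≡ sumFin n u
  sumFin-cong zero h = refl
  sumFin-cong (suc n) h = cong₂ _+_ (h Fin.zero) (sumFin-cong n (h ∘ Fin.suc))

  toℕ-punchIn : ∀ {n} (j : Fin (suc n)) (b : Fin n) → toℕ (Fin.punchIn j b) ≡ punchIn (toℕ j) (toℕ b)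
  toℕ-punchIn Fin.zero b = refl
  toℕ-punchIn (Fin.suc j) Fin.zero = refl
  toℕ-punchIn (Fin.suc j) (Fin.suc b) = cong suc (toℕ-punchIn j b)

  det-cong : ∀ n (M M' : Fin n → Fin n → ℤ) → (∀ a b → M a b ≡ M' a b) → det n M ≡ det n M'
  det-cong zero M M' h = refl
  det-cong (suc n) M M' h =
    trans (foldr-tabulate (suc n) (λ x → x) (λ j → sgn (toℕ j) * M Fin.zero j * det n (λ a b → M (Fin.suc a) (Fin.punchIn j b))))
      (trans (sumFin-cong (suc n) (λ j → cong₂ _*_ (cong (sgn (toℕ j) *_) (h Fin.zero j))
                (det-cong n _ _ (λ a b → h (Fin.suc a) (Fin.punchIn j b)))))
        (sym (foldr-tabulate (suc n) (λ x → x) (λ j → sgn (toℕ j) * M' Fin.zero j * det n (λ a b → M' (Fin.suc a) (Fin.punchIn j b))))))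

  det≡det′ : ∀ n (E : Matrix) → det n (λ a b → E (toℕ a) (toℕ b)) ≡ det′ n E
  det≡det′ zero E = refl
  det≡det′ (suc n) E =
    trans (foldr-tabulate (suc n) (λ x → x) (λ j → sgn (toℕ j) * E 0 (toℕ j) * det n (λ a b → E (toℕ (Fin.suc a)) (toℕ (Fin.punchIn j b)))))
      (trans (sumFin-cong (suc n) (λ j → cong (sgn (toℕ j) * E 0 (toℕ j) *_)
                (trans (det-cong n _ (λ a b → E (suc (toℕ a)) (punchIn (toℕ j) (toℕ b)))
                          (λ a b → cong (E (suc (toℕ a))) (toℕ-punchIn j b)))
                       (det≡det′ n (λ a b → E (suc a) (punchIn (toℕ j) b))))))
        (sumFin-toℕ (suc n) (λ j → sgn j * E 0 j * det′ n (λ a b → E (suc a) (punchIn j b)))))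

  det′-linearCol : ∀ n j → j ℕ.< n → (A B C : Matrix) (k : ℤ) →
    (∀ a b → b ≢ j → A a b ≡ B a b) → (∀ a b → b ≢ j → C a b ≡ B a b) →
    (∀ a → A a j ≡ B a j + k * C a j) → det′ n A ≡ det′ n B + k * det′ n C
  det′-linearCol (suc n) j j< A B C k hAB hCB hj =
    trans (sum-cong (suc n) term)
      (trans (sum-+ (suc n) tB (λ i → k * tC i)) (cong (_+_ (sum< (suc n) tB)) (sum-* (suc n) k tC)))
    where
    tB tC : ℕ → ℤ
    tB i = sgn i * B 0 i * det′ n (λ a b → B (suc a) (punchIn i b))
    tC i = sgn i * C 0 i * det′ n (λ a b → C (suc a) (punchIn i b))
    splitRow : ∀ s x y k d → s * (x + k * y) * d ≡ s * x * d + k * (s * y * d)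
    splitRow = solve-∀
    splitMinor : ∀ s x k d e → s * x * (d + k * e) ≡ s * x * d + k * (s * x * e)
    splitMinor = solve-∀
    term : ∀ i → i ℕ.< suc n →
      sgn i * A 0 i * det′ n (λ a b → A (suc a) (punchIn i b)) ≡
      sgn i * B 0 i * det′ n (λ a b → B (suc a) (punchIn i b)) + k * (sgn i * C 0 i * det′ n (λ a b → C (suc a) (punchIn i b)))
    term i i< with i ℕ.≟ j
    ... | yes refl =
      trans (cong₂ (λ x y → sgn i * x * y) (hj 0)
               (det′-cong n _ _ (λ a b _ _ → hAB (suc a) (punchIn i b) (punchIn≢ i b))))
        (trans (splitRow (sgn i) (B 0 i) (C 0 i) k _)
          (cong (λ y → sgn i * B 0 i * det′ n (λ a b → B (suc a) (punchIn i b)) + k * (sgn i * C 0 i * y))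
            (det′-cong n _ _ (λ a b _ _ → sym (hCB (suc a) (punchIn i b) (punchIn≢ i b))))))
    ... | no i≢j =
      trans (cong₂ (λ x y → sgn i * x * y) (hAB 0 i i≢j) ih)
        (trans (splitMinor (sgn i) (B 0 i) k _ _)
          (cong (λ x → sgn i * B 0 i * det′ n (λ a b → B (suc a) (punchIn i b)) + k * (sgn i * x * det′ n (λ a b → C (suc a) (punchIn i b))))
            (sym (hCB 0 i i≢j))))
      where
      j' = punchOut i j
      e : punchIn i j' ≡ j
      e = punchIn-punchOut i j i≢j
      ne : ∀ b → b ≢ j' → punchIn i b ≢ j
      ne b b≢ q = b≢ (punchIn-injective i b j' (trans q (sym e)))
      ih : det′ n (λ a b → A (suc a) (punchIn i b)) ≡
           det′ n (λ a b → B (suc a) (punchIn i b)) + k * det′ n (λ a b → C (suc a) (punchIn i b))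
      ih = det′-linearCol n j' (punchOut< n i j i< j< i≢j) _ _ _ k
        (λ a b b≢ → hAB (suc a) (punchIn i b) (ne b b≢))
        (λ a b b≢ → hCB (suc a) (punchIn i b) (ne b b≢))
        (λ a → subst (λ z → A (suc a) z ≡ B (suc a) z + k * C (suc a) z) (sym e) (hj (suc a)))

  -- A matrix with two equal adjacent columns has determinant 0
  -- (by induction: the two surviving terms of the expansion cancel).
  det′-adjacentEqualCols : ∀ n c (E : Matrix) → suc c ℕ.< n → (∀ a → E a c ≡ E a (suc c)) → det′ n E ≡ + 0
  det′-adjacentEqualCols (suc n) c E lt h = sum-adjacentPair (suc n) c _ lt other pair
    where
    other : ∀ i → i ℕ.< suc n → i ≢ c → i ≢ suc c →
      sgn i * E 0 i * det′ n (λ a b → E (suc a) (punchIn i b)) ≡ + 0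
    other i i< ne1 ne2 with adjacentPair-punchIn n i c i< lt ne1 ne2
    ... | c' , lt' , e1 , e2 =
      trans (cong (sgn i * E 0 i *_)
               (det′-adjacentEqualCols n c' _ lt' (λ a → trans (cong (E (suc a)) e1) (trans (h (suc a)) (cong (E (suc a)) (sym e2))))))
            (ℤP.*-zeroʳ (sgn i * E 0 i))
    mineq : det′ n (λ a b → E (suc a) (punchIn c b)) ≡ det′ n (λ a b → E (suc a) (punchIn (suc c) b))
    mineq = det′-cong n _ _ λ a b _ _ → f a b (punchIn-adjacent c b)
      where
      f : ∀ a b → punchIn c b ≡ punchIn (suc c) b ⊎ (punchIn c b ≡ suc c × punchIn (suc c) b ≡ c) →
          E (suc a) (punchIn c b) ≡ E (suc a) (punchIn (suc c) b)
      f a b (inj₁ e) = cong (E (suc a)) e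
      f a b (inj₂ (e1 , e2)) = trans (cong (E (suc a)) e1) (trans (sym (h (suc a))) (cong (E (suc a)) (sym e2)))
    cancel : ∀ s x d → s * x * d + - s * x * d ≡ + 0
    cancel = solve-∀
    pair : sgn c * E 0 c * det′ n (λ a b → E (suc a) (punchIn c b)) +
           sgn (suc c) * E 0 (suc c) * det′ n (λ a b → E (suc a) (punchIn (suc c) b)) ≡ + 0
    pair = trans (cong₂ (λ x y → sgn c * E 0 c * det′ n (λ a b → E (suc a) (punchIn c b)) + - sgn c * x * y) (sym (h 0)) (sym mineq))
             (cancel (sgn c) (E 0 c) _)

  -- Laplace expansion along the first column, by expanding twice and swapping sums.
  det′-firstCol : ∀ n (E : Matrix) → det′ (suc n) E ≡ sum< (suc n) (λ i → sgn i * E i 0 * det′ n (λ a b → E (punchIn i a) (suc b)))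
  det′-firstCol zero E = refl
  det′-firstCol (suc n) E = cong (_+_ (sgn 0 * E 0 0 * det′ (suc n) (λ a b → E (suc a) (suc b)))) rest
    where
    D : ℕ → ℕ → ℤ
    D i j = det′ n (λ a b → E (suc (punchIn i a)) (suc (punchIn j b)))
    commuteSigns : ∀ s t x y d → - s * x * (t * y * d) ≡ - t * y * (s * x * d)
    commuteSigns = solve-∀
    rest : sum< (suc n) (λ j → sgn (suc j) * E 0 (suc j) * det′ (suc n) (λ a b → E (suc a) (punchIn (suc j) b))) ≡
           sum< (suc n) (λ i → sgn (suc i) * E (suc i) 0 * det′ (suc n) (λ a b → E (punchIn (suc i) a) (suc b)))
    rest = begin
        sum< (suc n) (λ j → sgn (suc j) * E 0 (suc j) * det′ (suc n) (λ a b → E (suc a) (punchIn (suc j) b)))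
      ≡⟨ sum-cong (suc n) (λ j _ → trans (cong (sgn (suc j) * E 0 (suc j) *_) (det′-firstCol n (λ a b → E (suc a) (punchIn (suc j) b))))
                                      (sym (sum-* (suc n) (sgn (suc j) * E 0 (suc j)) (λ i → sgn i * E (suc i) 0 * D i j)))) ⟩
        sum< (suc n) (λ j → sum< (suc n) (λ i → sgn (suc j) * E 0 (suc j) * (sgn i * E (suc i) 0 * D i j)))
      ≡⟨ sum-swap (suc n) (suc n) (λ j i → sgn (suc j) * E 0 (suc j) * (sgn i * E (suc i) 0 * D i j)) ⟩
        sum< (suc n) (λ i → sum< (suc n) (λ j → sgn (suc j) * E 0 (suc j) * (sgn i * E (suc i) 0 * D i j)))
      ≡⟨ sum-cong (suc n) (λ i _ → trans (sum-cong (suc n) (λ j _ → commuteSigns (sgn j) (sgn i) (E 0 (suc j)) (E (suc i) 0) (D i j)))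
                                       (sum-* (suc n) (sgn (suc i) * E (suc i) 0) (λ j → sgn j * E 0 (suc j) * D i j))) ⟩
        sum< (suc n) (λ i → sgn (suc i) * E (suc i) 0 * det′ (suc n) (λ a b → E (punchIn (suc i) a) (suc b)))
      ∎
      where open ≡-Reasoning

  -- det′ Eᵀ = det′ E: row expansion of Eᵀ is column expansion of E.
  det′-transpose : ∀ n (E : Matrix) → det′ n (λ a b → E b a) ≡ det′ n E
  det′-transpose zero E = refl
  det′-transpose (suc n) E =
    trans (sum-cong (suc n) (λ j _ → cong (sgn j * E j 0 *_) (det′-transpose n (λ a b → E (punchIn j a) (suc b)))))
          (sym (det′-firstCol n E))

  det′-lastCol : ∀ n (E : Matrix) → (∀ a → a ℕ.< n → E a n ≡ + 0) → det′ (suc n) E ≡ E n n * det′ n E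
  det′-lastCol zero E h = oneByOne (E 0 0)
    where
    oneByOne : ∀ x → + 1 * x * + 1 + + 0 ≡ x * + 1
    oneByOne = solve-∀
  det′-lastCol (suc n) E h = begin
      sum< (suc (suc n)) t
    ≡⟨ sum-last (suc n) t ⟩
      sum< (suc n) t + t (suc n)
    ≡⟨ cong (_+_ (sum< (suc n) t)) tlast ⟩
      sum< (suc n) t + + 0
    ≡⟨ ℤP.+-identityʳ _ ⟩
      sum< (suc n) t
    ≡⟨ sum-cong (suc n) step ⟩
      sum< (suc n) (λ j → E (suc n) (suc n) * (sgn j * E 0 j * det′ n (λ a b → E (suc a) (punchIn j b))))
    ≡⟨ sum-* (suc n) (E (suc n) (suc n)) (λ j → sgn j * E 0 j * det′ n (λ a b → E (suc a) (punchIn j b))) ⟩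
      E (suc n) (suc n) * det′ (suc n) E
    ∎
    where
    open ≡-Reasoning
    t : ℕ → ℤ
    t j = sgn j * E 0 j * det′ (suc n) (λ a b → E (suc a) (punchIn j b))
    tlast : t (suc n) ≡ + 0
    tlast = trans (cong (λ x → sgn (suc n) * x * det′ (suc n) (λ a b → E (suc a) (punchIn (suc n) b))) (h 0 (s≤s z≤n)))
              (cong (_* det′ (suc n) (λ a b → E (suc a) (punchIn (suc n) b))) (ℤP.*-zeroʳ (sgn (suc n))))
    pullOut : ∀ s x y d → s * x * (y * d) ≡ y * (s * x * d)
    pullOut = solve-∀
    step : ∀ j → j ℕ.< suc n → t j ≡ E (suc n) (suc n) * (sgn j * E 0 j * det′ n (λ a b → E (suc a) (punchIn j b)))
    step j (s≤s j≤n) =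
      trans (cong (sgn j * E 0 j *_)
              (trans (det′-lastCol n (λ a b → E (suc a) (punchIn j b))
                        (λ a a< → trans (cong (E (suc a)) (punchIn-last n j j≤n)) (h (suc a) (s≤s a<))))
                     (cong (_* det′ n (λ a b → E (suc a) (punchIn j b))) (cong (E (suc n)) (punchIn-last n j j≤n)))))
            (pullOut (sgn j) (E 0 j) (E (suc n) (suc n)) (det′ n (λ a b → E (suc a) (punchIn j b))))

  det′-identity : ∀ n (E : Matrix) → (∀ a → a ℕ.< n → E a a ≡ + 1) → (∀ a b → a ℕ.< n → b ℕ.< n → a ≢ b → E a b ≡ + 0) →
    det′ n E ≡ + 1
  det′-identity zero E h1 h0 = refl
  det′-identity (suc n) E h1 h0 =
    trans (det′-lastCol n E (λ a a< → h0 a n (ℕP.≤-trans a< (ℕP.n≤1+n n)) ℕP.≤-refl (ℕP.<⇒≢ a<)))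
      (cong₂ _*_ (h1 n ℕP.≤-refl)
                (det′-identity n E (λ a a< → h1 a (ℕP.≤-trans a< (ℕP.n≤1+n n)))
                   (λ a b a< b< → h0 a b (ℕP.≤-trans a< (ℕP.n≤1+n n)) (ℕP.≤-trans b< (ℕP.n≤1+n n)))))

  replaceCol : Matrix → ℕ → ℕ → Matrix
  replaceCol E j j2 a b with b ℕ.≟ j
  ... | yes _ = E a j2
  ... | no _ = E a b

  replaceCol-at : ∀ E j j2 a → replaceCol E j j2 a j ≡ E a j2
  replaceCol-at E j j2 a with j ℕ.≟ j
  ... | yes _ = refl
  ... | no ne = ⊥-elim (ne refl)

  replaceCol-other : ∀ E j j2 a b → b ≢ j → replaceCol E j j2 a b ≡ E a b
  replaceCol-other E j j2 a b ne with b ℕ.≟ j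
  ... | yes e = ⊥-elim (ne e)
  ... | no _ = refl

  det′-addAdjacentCol : ∀ n (E E' : Matrix) j j2 k → j ℕ.< n → j2 ℕ.< n → (j2 ≡ suc j ⊎ j ≡ suc j2) →
    (∀ a b → b ≢ j → E' a b ≡ E a b) → (∀ a → E' a j ≡ E a j + k * E a j2) → det′ n E' ≡ det′ n E
  det′-addAdjacentCol n E E' j j2 k j< j2< adj unchanged pivot =
    trans (det′-linearCol n j j< E' E (replaceCol E j j2) k unchanged (λ a b ne → replaceCol-other E j j2 a b ne)
            (λ a → trans (pivot a) (cong (λ x → E a j + k * x) (sym (replaceCol-at E j j2 a)))))
      (trans (cong (λ x → det′ n E + k * x) (duplicateCol-det adj)) (trans (cong (_+_ (det′ n E)) (ℤP.*-zeroʳ k)) (ℤP.+-identityʳ _)))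
    where
    duplicateCol-det : (j2 ≡ suc j ⊎ j ≡ suc j2) → det′ n (replaceCol E j j2) ≡ + 0
    duplicateCol-det (inj₁ refl) = det′-adjacentEqualCols n j (replaceCol E j j2) j2<
            (λ a → trans (replaceCol-at E j j2 a) (sym (replaceCol-other E j j2 a (suc j) ℕP.1+n≢n)))
    duplicateCol-det (inj₂ refl) = det′-adjacentEqualCols n j2 (replaceCol E j j2) j<
            (λ a → trans (replaceCol-other E j j2 a j2 (ℕP.1+n≢n ∘ sym)) (sym (replaceCol-at E j j2 a)))

  det′-addAdjacentRow : ∀ n (E E' : Matrix) r r2 k → r ℕ.< n → r2 ℕ.< n → (r2 ≡ suc r ⊎ r ≡ suc r2) →
    (∀ a b → a ≢ r → E' a b ≡ E a b) → (∀ b → E' r b ≡ E r b + k * E r2 b) → det′ n E' ≡ det′ n E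
  det′-addAdjacentRow n E E' r r2 k r< r2< adj h1 h2 =
    trans (sym (det′-transpose n E'))
      (trans (det′-addAdjacentCol n (λ a b → E b a) (λ a b → E' b a) r r2 k r< r2< adj (λ a b ne → h1 b a ne) (λ a → h2 a))
        (det′-transpose n E))

module SylvesterReduction where

  open import Data.Nat as ℕ using (ℕ; zero; suc; z≤n; s≤s; _∸_)
  import Data.Nat.Properties as ℕP
  open import Data.Integer as ℤ using (ℤ; +_; _+_; _*_; -_; _-_)
  open import Data.Integer.Tactic.RingSolver
  open import Relation.Binary.PropositionalEquality
  open import Relation.Nullary using (¬_; yes; no; Dec)
  open import Relation.Nullary.Decidable using (_×-dec_)
  open import Data.Empty using (⊥-elim)
  open import Data.Sum using (inj₁; inj₂)
  open import Data.Product using (_×_; _,_)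
  open import Data.List using ([]; _∷_; length)
  open Determinant

  ifDec : ∀ {A : Set} {P : Set} → Dec P → A → A → A
  ifDec (yes _) x y = x
  ifDec (no _) x y = y

  ifDec-yes : ∀ {A P : Set} (d : Dec P) (x y : A) → P → ifDec d x y ≡ x
  ifDec-yes (yes _) x y p = refl
  ifDec-yes (no np) x y p = ⊥-elim (np p)

  ifDec-no : ∀ {A P : Set} (d : Dec P) (x y : A) → ¬ P → ifDec d x y ≡ y
  ifDec-no (yes p) x y np = ⊥-elim (np p)
  ifDec-no (no _) x y np = refl

  ∸-suc : ∀ K b → b ℕ.< K → K ∸ b ≡ suc (K ∸ suc b)
  ∸-suc (suc K) zero _ = refl
  ∸-suc (suc K) (suc b) (s≤s lt) = ∸-suc K b lt

  -- shift k A is the coefficient sequence of x^k · A.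
  shift : ℕ → (ℕ → ℤ) → ℕ → ℤ
  shift zero A t = A t
  shift (suc k) A zero = + 0
  shift (suc k) A (suc t) = shift k A t

  shift-below : ∀ k A t → t ℕ.< k → shift k A t ≡ + 0
  shift-below (suc k) A zero _ = refl
  shift-below (suc k) A (suc t) (s≤s lt) = shift-below k A t lt

  shift-at : ∀ k A u → shift k A (k ℕ.+ u) ≡ A u
  shift-at zero A u = refl
  shift-at (suc k) A u = shift-at k A u

  shift-at′ : ∀ k A t u → t ≡ k ℕ.+ u → shift k A t ≡ A u
  shift-at′ k A t u refl = shift-at k A u

  shift-cong : ∀ k {A B : ℕ → ℤ} → (∀ t → A t ≡ B t) → ∀ t → shift k A t ≡ shift k B t
  shift-cong zero h t = h t
  shift-cong (suc k) h zero = refl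
  shift-cong (suc k) h (suc t) = shift-cong k h t

  shift-suc : ∀ j A t → shift (suc j) A t ≡ shift 1 (shift j A) t
  shift-suc j A zero = refl
  shift-suc j A (suc t) = refl

  shift-beyond : ∀ k d A → (∀ t → d ℕ.≤ t → A t ≡ + 0) → ∀ t → k ℕ.+ d ℕ.≤ t → shift k A t ≡ + 0
  shift-beyond zero d A h t le = h t le
  shift-beyond (suc k) d A h zero ()
  shift-beyond (suc k) d A h (suc t) (s≤s le) = shift-beyond k d A h t le

  -- mulLinear c Q is the coefficient sequence of (x - c) · Q.
  mulLinear : ℤ → (ℕ → ℤ) → ℕ → ℤ
  mulLinear c Q t = shift 1 Q t - c * Q t

  mulLinear-cong : ∀ c {Q Q' : ℕ → ℤ} → (∀ t → Q t ≡ Q' t) → ∀ t → mulLinear c Q t ≡ mulLinear c Q' t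
  mulLinear-cong c h t = cong₂ (λ x y → x - c * y) (shift-cong 1 h t) (h t)

  shift-mulLinear : ∀ k c Q t → shift k (mulLinear c Q) t ≡ mulLinear c (shift k Q) t
  shift-mulLinear zero c Q t = refl
  shift-mulLinear (suc k) c Q zero = sym (byRing c)
    where
    byRing : ∀ c → + 0 - c * + 0 ≡ + 0
    byRing = solve-∀
  shift-mulLinear (suc k) c Q (suc t) = trans (shift-mulLinear k c Q t) (cong (λ x → x - c * shift k Q t) (sym (shift-suc k Q t)))

  -- horner c v t = Σ_{i ≤ t} c^(t-i) v i, the Horner partial sums of v at c.
  horner : ℤ → (ℕ → ℤ) → ℕ → ℤ
  horner c v zero = v 0
  horner c v (suc t) = v (suc t) + c * horner c v t

  horner-cong : ∀ c (v w : ℕ → ℤ) b → (∀ i → i ℕ.≤ b → v i ≡ w i) → horner c v b ≡ horner c w b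
  horner-cong c v w zero h = h 0 z≤n
  horner-cong c v w (suc b) h =
    cong₂ (λ x y → x + c * y) (h (suc b) ℕP.≤-refl) (horner-cong c v w b (λ i le → h i (ℕP.m≤n⇒m≤1+n le)))

  -- Synthetic division: the Horner sums at c of the (reversed) coefficients of
  -- (x - c)·Q, where Q has degree < K, are the (reversed, shifted) coefficients of Q.
  horner-mulLinear : ∀ K c Q (v : ℕ → ℤ) → (∀ b → b ℕ.≤ K → v b ≡ mulLinear c Q (K ∸ b)) → Q K ≡ + 0 →
    ∀ b → b ℕ.≤ K → horner c v b ≡ shift 1 Q (K ∸ b)
  horner-mulLinear K c Q v hv hQ zero _ = trans (hv 0 z≤n) (trans (cong (λ x → shift 1 Q K - c * x) hQ) (byRing c (shift 1 Q K)))
    where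
    byRing : ∀ c x → x - c * + 0 ≡ x
    byRing = solve-∀
  horner-mulLinear K c Q v hv hQ (suc b) lt =
    trans (cong₂ (λ x y → x + c * y) (hv (suc b) lt) (horner-mulLinear K c Q v hv hQ b (ℕP.<⇒≤ lt)))
      (trans (cong (λ z → mulLinear c Q (K ∸ suc b) + c * shift 1 Q z) (∸-suc K b lt))
        (byRing c (shift 1 Q (K ∸ suc b)) (Q (K ∸ suc b))))
    where
    byRing : ∀ c x y → x - c * y + c * y ≡ x
    byRing = solve-∀

  horner-zero : ∀ c b → horner c (λ _ → + 0) b ≡ + 0
  horner-zero c zero = refl
  horner-zero c (suc b) = trans (cong (λ x → + 0 + c * x) (horner-zero c b)) (byRing c)
    where
    byRing : ∀ c → + 0 + c * + 0 ≡ + 0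
    byRing = solve-∀

  horner-eval : ∀ K c (g : Poly) → length g ℕ.≤ suc K → horner c (λ b → coeff g (K ∸ b)) K ≡ eval g c
  horner-eval zero c [] _ = refl
  horner-eval zero c (a ∷ []) _ = sym (byRing a c)
    where
    byRing : ∀ a c → a + c * + 0 ≡ a
    byRing = solve-∀
  horner-eval zero c (a ∷ b ∷ g) (s≤s ())
  horner-eval (suc K) c [] _ = horner-zero c (suc K)
  horner-eval (suc K) c (a ∷ g) (s≤s lg) =
    cong₂ (λ y x → y + c * x) (cong (coeff (a ∷ g)) (ℕP.n∸n≡0 K))
      (trans (horner-cong c _ (λ b → coeff g (K ∸ b)) K
                (λ i le → cong (coeff (a ∷ g)) (∸-suc (suc K) i (s≤s le))))
        (horner-eval K c g lg))

  -- Row r of the Sylvester matrix of F (degree m) and G (degree ≤ n), as a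
  -- coefficient sequence: x^(n-1-r)·F for r < n and x^(m-1-(r-n))·G otherwise.
  sylRow : ℕ → ℕ → (ℕ → ℤ) → (ℕ → ℤ) → ℕ → ℕ → ℤ
  sylRow m n F G r = ifDec (r ℕ.<? n) (shift (n ∸ suc r) F) (shift (m ∸ suc (r ∸ n)) G)

  -- Column c holds the coefficient of degree n+m-1-c.
  sylMatrix : ℕ → ℕ → (ℕ → ℤ) → (ℕ → ℤ) → Matrix
  sylMatrix m n F G r c = sylRow m n F G r ((n ℕ.+ m) ∸ suc c)

  inRange? : ∀ lo t a → Dec (lo ℕ.≤ a × a ℕ.< lo ℕ.+ t)
  inRange? lo t a = (lo ℕ.≤? a) ×-dec (a ℕ.<? lo ℕ.+ t)

  rowSweep : Matrix → ℕ → ℤ → ℕ → Matrix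
  rowSweep E lo k t a b = ifDec (inRange? lo t a) (E a b + k * E (suc a) b) (E a b)

  -- The row sweep is a sequence of adjacent row operations, so it keeps the determinant.
  det′-rowSweep : ∀ N (E : Matrix) lo k t → lo ℕ.+ t ℕ.< N → det′ N (rowSweep E lo k t) ≡ det′ N E
  det′-rowSweep N E lo k zero lt = det′-cong N _ _ λ a b _ _ →
    ifDec-no (inRange? lo 0 a) _ _ λ (p , q) → ℕP.<-irrefl refl (ℕP.<-≤-trans q (subst (ℕ._≤ a) (sym (ℕP.+-identityʳ lo)) p))
  det′-rowSweep N E lo k (suc t) lt =
    trans (det′-addAdjacentRow N (rowSweep E lo k t) (rowSweep E lo k (suc t)) (lo ℕ.+ t) (suc (lo ℕ.+ t)) k lt1 lt2 (inj₁ refl) unchanged pivot)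
      (det′-rowSweep N E lo k t lt1)
    where
    eq : lo ℕ.+ suc t ≡ suc (lo ℕ.+ t)
    eq = ℕP.+-suc lo t
    lt2 : suc (lo ℕ.+ t) ℕ.< N
    lt2 = subst (ℕ._< N) eq lt
    lt1 : lo ℕ.+ t ℕ.< N
    lt1 = ℕP.<-trans (ℕP.n<1+n _) lt2
    unchanged : ∀ a b → a ≢ lo ℕ.+ t → rowSweep E lo k (suc t) a b ≡ rowSweep E lo k t a b
    unchanged a b ne with inRange? lo (suc t) a | inRange? lo t a
    ... | yes _ | yes _ = refl
    ... | no _ | no _ = refl
    ... | yes (p , q) | no nq = ⊥-elim (nq (p , ℕP.≤∧≢⇒< (ℕP.≤-pred (subst (suc a ℕ.≤_) eq q)) ne))
    ... | no np | yes (p , q) = ⊥-elim (np (p , ℕP.<-trans q (subst (lo ℕ.+ t ℕ.<_) (sym eq) (ℕP.n<1+n _))))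
    notin : ∀ a → lo ℕ.+ t ℕ.≤ a → ¬ (lo ℕ.≤ a × a ℕ.< lo ℕ.+ t)
    notin a le (_ , q) = ℕP.<-irrefl refl (ℕP.<-≤-trans q le)
    pivot : ∀ b → rowSweep E lo k (suc t) (lo ℕ.+ t) b ≡ rowSweep E lo k t (lo ℕ.+ t) b + k * rowSweep E lo k t (suc (lo ℕ.+ t)) b
    pivot b = trans (ifDec-yes (inRange? lo (suc t) (lo ℕ.+ t)) _ _ (ℕP.m≤m+n lo t , subst (lo ℕ.+ t ℕ.<_) (sym eq) (ℕP.n<1+n _)))
             (cong₂ (λ x y → x + k * y)
               (sym (ifDec-no (inRange? lo t (lo ℕ.+ t)) _ _ (notin _ ℕP.≤-refl)))
               (sym (ifDec-no (inRange? lo t (suc (lo ℕ.+ t))) _ _ (notin _ (ℕP.n≤1+n _)))))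

  hornerSweep : Matrix → ℤ → ℕ → Matrix
  hornerSweep E c t a b = ifDec (b ℕ.≤? t) (horner c (E a) b) (E a b)

  -- The Horner sweep is a sequence of adjacent column operations, so it keeps the determinant.
  det′-hornerSweep : ∀ N (E : Matrix) c t → t ℕ.< N → det′ N (hornerSweep E c t) ≡ det′ N E
  det′-hornerSweep N E c zero lt = det′-cong N _ _ λ a b _ _ → f a b
    where
    f : ∀ a b → hornerSweep E c 0 a b ≡ E a b
    f a zero = ifDec-yes (0 ℕ.≤? 0) (horner c (E a) 0) (E a 0) z≤n
    f a (suc b) = ifDec-no (suc b ℕ.≤? 0) (horner c (E a) (suc b)) (E a (suc b)) (λ ())
  det′-hornerSweep N E c (suc t) lt =
    trans (det′-addAdjacentCol N (hornerSweep E c t) (hornerSweep E c (suc t)) (suc t) t c lt (ℕP.<-trans (ℕP.n<1+n t) lt) (inj₂ refl) unchanged pivot)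
      (det′-hornerSweep N E c t (ℕP.<-trans (ℕP.n<1+n t) lt))
    where
    unchanged : ∀ a b → b ≢ suc t → hornerSweep E c (suc t) a b ≡ hornerSweep E c t a b
    unchanged a b ne with b ℕ.≤? suc t | b ℕ.≤? t
    ... | yes _ | yes _ = refl
    ... | no _ | no _ = refl
    ... | yes p | no np = ⊥-elim (np (ℕP.≤-pred (ℕP.≤∧≢⇒< p ne)))
    ... | no np | yes p = ⊥-elim (np (ℕP.m≤n⇒m≤1+n p))
    pivot : ∀ a → hornerSweep E c (suc t) a (suc t) ≡ hornerSweep E c t a (suc t) + c * hornerSweep E c t a t
    pivot a = trans (ifDec-yes (suc t ℕ.≤? suc t) _ _ ℕP.≤-refl)
             (cong₂ (λ x y → x + c * y)
                (sym (ifDec-no (suc t ℕ.≤? t) _ _ (ℕP.<⇒≱ (ℕP.n<1+n t))))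
                (sym (ifDec-yes (t ℕ.≤? t) _ _ ℕP.≤-refl)))

module LinearProductResultant where

  open import Data.Nat as ℕ using (ℕ; zero; suc; z≤n; s≤s; _∸_; _⊔_)
  import Data.Nat.Properties as ℕP
  import Data.Nat.Tactic.RingSolver as NS
  open import Data.Integer as ℤ using (ℤ; +_; _+_; _*_; -_; _-_)
  import Data.Integer.Properties as ℤP
  open import Data.Integer.Tactic.RingSolver
  open import Relation.Binary.PropositionalEquality
  open import Relation.Nullary using (¬_; yes; no; Dec)
  open import Data.Empty using (⊥-elim)
  open import Data.Product using (Σ-syntax; _×_; _,_; proj₁; proj₂)
  open import Data.List using (List; []; _∷_; foldr; map; length)
  open import Function using (_∘_)
  open Determinant
  open SylvesterReduction

  split< : ∀ {a n} → a ℕ.< n → Σ[ e ∈ ℕ ] n ≡ suc a ℕ.+ e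
  split< lt with ℕP.m≤n⇒∃[o]m+o≡n lt
  ... | e , eq = e , sym eq

  split≤ : ∀ {a n} → a ℕ.≤ n → Σ[ e ∈ ℕ ] n ≡ a ℕ.+ e
  split≤ lt with ℕP.m≤n⇒∃[o]m+o≡n lt
  ... | e , eq = e , sym eq

  ∸-eq : ∀ n x y → n ≡ x ℕ.+ y → n ∸ x ≡ y
  ∸-eq n x y refl = ℕP.m+n∸m≡n x y

  coeff-⊕ : ∀ p q t → coeff (p ⊕ q) t ≡ coeff p t + coeff q t
  coeff-⊕ [] q t = sym (ℤP.+-identityˡ _)
  coeff-⊕ (a ∷ p) [] t = sym (ℤP.+-identityʳ _)
  coeff-⊕ (a ∷ p) (b ∷ q) zero = refl
  coeff-⊕ (a ∷ p) (b ∷ q) (suc t) = coeff-⊕ p q t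

  coeff-scale : ∀ a q t → coeff (scale a q) t ≡ a * coeff q t
  coeff-scale a [] t = sym (ℤP.*-zeroʳ a)
  coeff-scale a (b ∷ q) zero = refl
  coeff-scale a (b ∷ q) (suc t) = coeff-scale a q t

  coeff-zeroP : ∀ t → coeff (+ 0 ∷ []) t ≡ + 0
  coeff-zeroP zero = refl
  coeff-zeroP (suc t) = refl

  coeff-linP⊗ : ∀ c h t → coeff (linP c ⊗ h) t ≡ mulLinear c (coeff h) t
  coeff-linP⊗ c h zero = trans (coeff-⊕ (scale (- c) h) _ 0)
    (trans (cong (_+ + 0) (coeff-scale (- c) h 0)) (byRing c (coeff h 0)))
    where
    byRing : ∀ c x → - c * x + + 0 ≡ + 0 - c * x
    byRing = solve-∀
  coeff-linP⊗ c h (suc t) = trans (coeff-⊕ (scale (- c) h) _ (suc t))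
    (trans (cong₂ _+_ (coeff-scale (- c) h (suc t))
             (trans (coeff-⊕ (scale (+ 1) h) (+ 0 ∷ []) t) (cong₂ _+_ (coeff-scale (+ 1) h t) (coeff-zeroP t))))
      (byRing c (coeff h (suc t)) (coeff h t)))
    where
    byRing : ∀ c x y → - c * x + (+ 1 * y + + 0) ≡ y - c * x
    byRing = solve-∀

  coeff-beyondLength : ∀ p t → length p ℕ.≤ t → coeff p t ≡ + 0
  coeff-beyondLength [] t _ = refl
  coeff-beyondLength (a ∷ p) (suc t) (s≤s le) = coeff-beyondLength p t le

  coeff-beyondDeg : ∀ p t → deg p ℕ.< t → coeff p t ≡ + 0
  coeff-beyondDeg [] t _ = refl
  coeff-beyondDeg (a ∷ p) t lt = coeff-beyondLength (a ∷ p) t lt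

  length-⊕ : ∀ p q → length (p ⊕ q) ≡ length p ⊔ length q
  length-⊕ [] q = refl
  length-⊕ (a ∷ p) [] = refl
  length-⊕ (a ∷ p) (b ∷ q) = cong suc (length-⊕ p q)

  length-scale : ∀ a q → length (scale a q) ≡ length q
  length-scale a q = Data.List.Properties.length-map (a *_) q
    where import Data.List.Properties

  linearProduct : List ℤ → Poly
  linearProduct = foldr (λ c acc → linP c ⊗ acc) (constP (+ 1))

  product : List ℤ → ℤ
  product = foldr _*_ (+ 1)

  length-linearProduct : ∀ cs → length (linearProduct cs) ≡ suc (length cs)
  length-linearProduct [] = refl
  length-linearProduct (c ∷ cs) =
    trans (length-⊕ (scale (- c) h) (+ 0 ∷ ((+ 1 ∷ []) ⊗ h)))
      (trans (cong₂ (λ x y → x ⊔ suc y) (length-scale (- c) h)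
               (trans (length-⊕ (scale (+ 1) h) (+ 0 ∷ [])) (cong (_⊔ 1) (length-scale (+ 1) h))))
        (trans (cong (λ y → length h ⊔ suc y) (ℕP.m≥n⇒m⊔n≡m (subst (1 ℕ.≤_) (sym lh) (s≤s z≤n))))
          (trans (ℕP.m≤n⇒m⊔n≡n (ℕP.n≤1+n (length h))) (cong suc lh))))
    where
    h = linearProduct cs
    lh : length h ≡ suc (length cs)
    lh = length-linearProduct cs

  shift-one : ∀ k t → t ≢ k → shift k (coeff (+ 1 ∷ [])) t ≡ + 0
  shift-one zero zero ne = ⊥-elim (ne refl)
  shift-one zero (suc t) _ = refl
  shift-one (suc k) zero _ = refl
  shift-one (suc k) (suc t) ne = shift-one k t (ne ∘ cong suc)

  -- For f = 1 the Sylvester matrix is the identity: its off-diagonal entries vanish.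
  shiftOne-offDiagonal : ∀ n a b → a ℕ.< n → b ℕ.< n → a ≢ b → shift (n ∸ suc a) (coeff (+ 1 ∷ [])) (n ∸ suc b) ≡ + 0
  shiftOne-offDiagonal n a b a< b< ne =
    shift-one (n ∸ suc a) (n ∸ suc b) (λ e → ne (sym (ℕP.suc-injective (ℕP.∸-cancelˡ-≡ b< a< e))))

  -- One reduction step for f = (x - c)·h, deg h = m', deg g ≤ n, K = n + m'.
  -- In the Sylvester matrix S₀ of (f, g), subtracting c times the next row from
  -- each of the rows n … K-1 gives S₁; Horner's column sweep with c then gives
  -- S₂.  Every row a < K of S₂ is row a of the Sylvester matrix of (h, g)
  -- followed by a zero, and the bottom-right entry of S₂ is g(c).
  module SylvesterStep (c : ℤ) (h g : Poly) (m' n : ℕ)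
                       (lh : length h ≡ suc m') (lg : length g ℕ.≤ suc n) where

    K : ℕ
    K = n ℕ.+ m'

    H G F : ℕ → ℤ
    H = coeff h
    G = coeff g
    F = coeff (linP c ⊗ h)

    S₀ S₁ S₂ : Matrix
    S₀ = sylMatrix (suc m') n F G
    S₁ = rowSweep S₀ n (- c) m'
    S₂ a b = horner c (S₁ a) b

    rowHG : ℕ → ℕ → ℤ
    rowHG a = sylRow m' n H G a

    S₀-row : ∀ a b → S₀ a b ≡ sylRow (suc m') n F G a (K ∸ b)
    S₀-row a b = cong (λ z → sylRow (suc m') n F G a (z ∸ suc b)) (ℕP.+-suc n m')

    H-beyond : ∀ t → suc m' ℕ.≤ t → H t ≡ + 0
    H-beyond t le = coeff-beyondLength h t (subst (ℕ._≤ t) (sym lh) le)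

    G-beyond : ∀ t → suc n ℕ.≤ t → G t ≡ + 0
    G-beyond t le = coeff-beyondLength g t (ℕP.≤-trans lg le)

    SweptRow : ℕ → Set
    SweptRow a = (∀ b → S₁ a b ≡ mulLinear c (rowHG a) (K ∸ b)) × rowHG a K ≡ + 0

    -- The f-rows (a < n) were already multiples of (x - c): f = (x - c)·h.
    sweptRow-f : ∀ a → a ℕ.< n → SweptRow a
    sweptRow-f a a<n = rowP , degQ
      where
      k = n ∸ suc a
      Qa : ∀ t → rowHG a t ≡ shift k H t
      Qa t = cong (λ φ → φ t) (ifDec-yes (a ℕ.<? n) (shift (n ∸ suc a) H) (shift (m' ∸ suc (a ∸ n)) G) a<n)
      rowP : ∀ b → S₁ a b ≡ mulLinear c (rowHG a) (K ∸ b)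
      rowP b = trans (ifDec-no (inRange? n m' a) (S₀ a b + - c * S₀ (suc a) b) (S₀ a b) (λ (p , _) → ℕP.<⇒≱ a<n p))
        (trans (S₀-row a b)
          (trans (cong (λ φ → φ (K ∸ b)) (ifDec-yes (a ℕ.<? n) (shift (n ∸ suc a) F) (shift (suc m' ∸ suc (a ∸ n)) G) a<n))
            (trans (shift-cong k (coeff-linP⊗ c h) (K ∸ b))
              (trans (shift-mulLinear k c H (K ∸ b)) (sym (mulLinear-cong c Qa (K ∸ b)))))))
      e = proj₁ (split< a<n)
      hn = proj₂ (split< a<n)
      byRing : ∀ a e m → e ℕ.+ suc m ℕ.+ a ≡ suc a ℕ.+ e ℕ.+ m
      byRing = NS.solve-∀
      degQ : rowHG a K ≡ + 0
      degQ = trans (Qa K) (shift-beyond k (suc m') H H-beyond K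
        (subst (λ z → z ℕ.+ suc m' ℕ.≤ K) (sym (∸-eq n (suc a) e hn))
          (subst (λ z → e ℕ.+ suc m' ℕ.≤ z ℕ.+ m') (sym hn)
            (subst (e ℕ.+ suc m' ℕ.≤_) (byRing a e m') (ℕP.m≤m+n _ a)))))

    -- A g-row a ∈ [n, K) minus c times the next g-row (the same row shifted
    -- by one) is (x - c) times the shorter shift of g.
    sweptRow-g : ∀ a → n ℕ.≤ a → a ℕ.< K → SweptRow a
    sweptRow-g a n≤a a<K = rowP , degQ
      where
      i = proj₁ (split≤ n≤a)
      ha = proj₂ (split≤ n≤a)
      i<m : i ℕ.< m'
      i<m = ℕP.+-cancelˡ-< n i m' (subst (ℕ._< K) ha a<K)
      a≮n : ¬ a ℕ.< n
      a≮n = ℕP.≤⇒≯ n≤a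
      j = m' ∸ suc i
      a∸n : a ∸ n ≡ i
      a∸n = ∸-eq a n i ha
      sa∸n : suc a ∸ n ≡ suc i
      sa∸n = ∸-eq (suc a) n (suc i) (trans (cong suc ha) (sym (ℕP.+-suc n i)))
      Qa : ∀ t → rowHG a t ≡ shift j G t
      Qa t = trans (cong (λ φ → φ t) (ifDec-no (a ℕ.<? n) (shift (n ∸ suc a) H) (shift (m' ∸ suc (a ∸ n)) G) a≮n))
               (cong (λ z → shift (m' ∸ suc z) G t) a∸n)
      row₀ : ∀ b → S₀ a b ≡ shift (suc j) G (K ∸ b)
      row₀ b = trans (S₀-row a b) (trans (cong (λ φ → φ (K ∸ b)) (ifDec-no (a ℕ.<? n) (shift (n ∸ suc a) F) (shift (suc m' ∸ suc (a ∸ n)) G) a≮n))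
               (cong (λ z → shift z G (K ∸ b)) (trans (cong (λ z → m' ∸ z) a∸n) (∸-suc m' i i<m))))
      row₁ : ∀ b → S₀ (suc a) b ≡ shift j G (K ∸ b)
      row₁ b = trans (S₀-row (suc a) b) (trans (cong (λ φ → φ (K ∸ b)) (ifDec-no (suc a ℕ.<? n) (shift (n ∸ suc (suc a)) F) (shift (suc m' ∸ suc (suc a ∸ n)) G) (λ lt → a≮n (ℕP.<-trans (ℕP.n<1+n a) lt))))
               (cong (λ z → shift (m' ∸ z) G (K ∸ b)) sa∸n))
      sub≡ : ∀ c x y → x + - c * y ≡ x - c * y
      sub≡ = solve-∀
      rowP : ∀ b → S₁ a b ≡ mulLinear c (rowHG a) (K ∸ b)
      rowP b = trans (ifDec-yes (inRange? n m' a) (S₀ a b + - c * S₀ (suc a) b) (S₀ a b) (n≤a , a<K))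
        (trans (cong₂ (λ x y → x + - c * y) (row₀ b) (row₁ b))
          (trans (sub≡ c (shift (suc j) G (K ∸ b)) (shift j G (K ∸ b)))
            (trans (cong (λ x → x - c * shift j G (K ∸ b)) (shift-suc j G (K ∸ b)))
              (sym (mulLinear-cong c Qa (K ∸ b))))))
      e = proj₁ (split< i<m)
      hm = proj₂ (split< i<m)
      byRing : ∀ n i e → e ℕ.+ suc n ℕ.+ i ≡ n ℕ.+ (suc i ℕ.+ e)
      byRing = NS.solve-∀
      degQ : rowHG a K ≡ + 0
      degQ = trans (Qa K) (shift-beyond j (suc n) G G-beyond K
        (subst (λ z → z ℕ.+ suc n ℕ.≤ K) (sym (∸-eq m' (suc i) e hm))
          (subst (λ z → e ℕ.+ suc n ℕ.≤ n ℕ.+ z) (sym hm)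
            (subst (e ℕ.+ suc n ℕ.≤_) (byRing n i e) (ℕP.m≤m+n _ i)))))

    sweptRow : ∀ a → a ℕ.< K → SweptRow a
    sweptRow a a<K = byCase (a ℕ.<? n)
      where
      byCase : Dec (a ℕ.< n) → SweptRow a
      byCase (yes a<n) = sweptRow-f a a<n
      byCase (no a≮n) = sweptRow-g a (ℕP.≮⇒≥ a≮n) a<K

    -- Horner's sweep divides each upper row by (x - c).
    S₂-upper : ∀ a → a ℕ.< K → ∀ b → b ℕ.≤ K → S₂ a b ≡ shift 1 (rowHG a) (K ∸ b)
    S₂-upper a a< b b≤ =
      horner-mulLinear K c (rowHG a) (S₁ a) (λ b _ → proj₁ (sweptRow a a<) b) (proj₂ (sweptRow a a<)) b b≤

    S₂-lastCol : ∀ a → a ℕ.< K → S₂ a K ≡ + 0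
    S₂-lastCol a a< = trans (S₂-upper a a< K ℕP.≤-refl) (cong (shift 1 (rowHG a)) (ℕP.n∸n≡0 K))

    S₂-minor : ∀ a b → a ℕ.< K → b ℕ.< K → S₂ a b ≡ sylMatrix m' n H G a b
    S₂-minor a b a< b< = trans (S₂-upper a a< b (ℕP.<⇒≤ b<)) (cong (shift 1 (rowHG a)) (∸-suc K b b<))

    -- The last row is untouched by the row sweep: it holds g's coefficients,
    -- which Horner's sweep evaluates at c.
    S₁-lastRow : ∀ b → S₁ K b ≡ coeff g (K ∸ b)
    S₁-lastRow b =
      trans (ifDec-no (inRange? n m' K) (S₀ K b + - c * S₀ (suc K) b) (S₀ K b) (λ (_ , q) → ℕP.<-irrefl refl q))
        (trans (S₀-row K b)
          (trans (cong (λ φ → φ (K ∸ b)) (ifDec-no (K ℕ.<? n) (shift (n ∸ suc K) F) (shift (suc m' ∸ suc (K ∸ n)) G) (ℕP.≤⇒≯ (ℕP.m≤m+n n m'))))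
            (trans (cong (λ z → shift (m' ∸ z) G (K ∸ b)) (ℕP.m+n∸m≡n n m'))
              (cong (λ z → shift z G (K ∸ b)) (ℕP.n∸n≡0 m')))))

    S₂-corner : S₂ K K ≡ eval g c
    S₂-corner = trans (horner-cong c (S₁ K) (λ b → coeff g (K ∸ b)) K (λ i _ → S₁-lastRow i))
      (horner-eval K c g (ℕP.≤-trans lg (s≤s (ℕP.m≤m+n n m'))))

  det′-sylMatrix-linearProduct : ∀ (cs : List ℤ) (g : Poly) n → length g ℕ.≤ suc n →
    det′ (n ℕ.+ length cs) (sylMatrix (length cs) n (coeff (linearProduct cs)) (coeff g)) ≡ product (map (eval g) cs)
  det′-sylMatrix-linearProduct [] g n lg =
    trans (cong (λ z → det′ z (sylMatrix 0 n F1 (coeff g))) (ℕP.+-identityʳ n))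
      (det′-identity n _ diag off)
    where
    F1 = coeff (+ 1 ∷ [])
    n0 : n ℕ.+ 0 ≡ n
    n0 = ℕP.+-identityʳ n
    diag : ∀ a → a ℕ.< n → sylMatrix 0 n F1 (coeff g) a a ≡ + 1
    diag a a< = trans (cong (λ φ → φ ((n ℕ.+ 0) ∸ suc a)) (ifDec-yes (a ℕ.<? n) (shift (n ∸ suc a) F1) (shift (0 ∸ suc (a ∸ n)) (coeff g)) a<))
      (shift-at′ (n ∸ suc a) F1 _ 0 (trans (cong (_∸ suc a) n0) (sym (ℕP.+-identityʳ _))))
    off : ∀ a b → a ℕ.< n → b ℕ.< n → a ≢ b → sylMatrix 0 n F1 (coeff g) a b ≡ + 0
    off a b a< b< ne = trans (cong (λ φ → φ ((n ℕ.+ 0) ∸ suc b)) (ifDec-yes (a ℕ.<? n) (shift (n ∸ suc a) F1) (shift (0 ∸ suc (a ∸ n)) (coeff g)) a<))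
      (trans (cong (λ z → shift (n ∸ suc a) F1 (z ∸ suc b)) n0) (shiftOne-offDiagonal n a b a< b< ne))
  det′-sylMatrix-linearProduct (c ∷ cs) g n lg = begin
      det′ (n ℕ.+ suc (length cs)) S₀
    ≡⟨ cong (λ z → det′ z S₀) (ℕP.+-suc n (length cs)) ⟩
      det′ (suc K) S₀
    ≡⟨ sym (det′-rowSweep (suc K) S₀ n (- c) (length cs) (ℕP.n<1+n K)) ⟩
      det′ (suc K) S₁
    ≡⟨ sym (det′-hornerSweep (suc K) S₁ c K (ℕP.n<1+n K)) ⟩
      det′ (suc K) (hornerSweep S₁ c K)
    ≡⟨ det′-cong (suc K) _ S₂ (λ a b _ b< → ifDec-yes (b ℕ.≤? K) (horner c (S₁ a) b) (S₁ a b) (ℕP.≤-pred b<)) ⟩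
      det′ (suc K) S₂
    ≡⟨ det′-lastCol K S₂ S₂-lastCol ⟩
      S₂ K K * det′ K S₂
    ≡⟨ cong₂ _*_ S₂-corner (det′-cong K S₂ (sylMatrix (length cs) n H G) S₂-minor) ⟩
      eval g c * det′ K (sylMatrix (length cs) n H G)
    ≡⟨ cong (eval g c *_) (det′-sylMatrix-linearProduct cs g n lg) ⟩
      eval g c * product (map (eval g) cs)
    ∎
    where
    open ≡-Reasoning
    open SylvesterStep c (linearProduct cs) g (length cs) n (length-linearProduct cs) lg

module Resultant where

  open import Data.Nat as ℕ using (ℕ; zero; suc; z≤n; s≤s; _∸_)
  import Data.Nat.Properties as ℕP
  import Data.Nat.Tactic.RingSolver as NS
  open import Data.Integer as ℤ using (ℤ; +_; _+_)
  open import Relation.Binary.PropositionalEquality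
  open import Relation.Nullary using (yes; no; Dec)
  open import Data.Product using (proj₁; proj₂)
  open import Data.Bool using (true; false; T; if_then_else_; _∧_)
  open import Data.Unit using (tt)
  open import Data.Empty using (⊥-elim)
  open import Relation.Nullary using (¬_)
  open import Data.List using ([]; _∷_; map; length)
  open import Function using (_∘_)
  open Determinant
  open SylvesterReduction
  open LinearProductResultant

  if-T : ∀ {A : Set} b {x y : A} → T b → (if b then x else y) ≡ x
  if-T true _ = refl

  if-¬T : ∀ {A : Set} b {x y : A} → ¬ T b → (if b then x else y) ≡ y
  if-¬T true ¬t = ⊥-elim (¬t tt)
  if-¬T false _ = refl

  ≤ᵇ-suc : ∀ c d → (suc c ℕ.≤ᵇ suc d) ≡ (c ℕ.≤ᵇ d)
  ≤ᵇ-suc zero d = refl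
  ≤ᵇ-suc (suc c) d = refl

  -- Reading the band of reversed coefficients of A (degree ≤ d) in column c, when
  -- it starts at column 0, is reading x^k·A at degree d+k-c.
  bandFrom0 : ∀ d k c (A : ℕ → ℤ) → c ℕ.≤ d ℕ.+ k →
    (if c ℕ.≤ᵇ d then A (d ∸ c) else + 0) ≡ shift k A ((d ℕ.+ k) ∸ c)
  bandFrom0 d k zero A _ = sym (shift-at′ k A (d ℕ.+ k) d (ℕP.+-comm d k))
  bandFrom0 zero k (suc c) A le = sym (shift-below k A (k ∸ suc c) (ℕP.∸-monoʳ-< (s≤s z≤n) le))
  bandFrom0 (suc d) k (suc c) A (s≤s le) =
    trans (cong (λ b → if b then A (d ∸ c) else + 0) (≤ᵇ-suc c d)) (bandFrom0 d k c A le)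

  sylEntry-band : ∀ s d k c (A : ℕ → ℤ) → c ℕ.≤ s ℕ.+ d ℕ.+ k → (∀ t → d ℕ.< t → A t ≡ + 0) →
    (if (s ℕ.≤ᵇ c) ∧ (c ∸ s ℕ.≤ᵇ d) then A (d ∸ (c ∸ s)) else + 0) ≡ shift k A ((s ℕ.+ d ℕ.+ k) ∸ c)
  sylEntry-band zero d k c A le hA = bandFrom0 d k c A le
  sylEntry-band (suc s) d k zero A le hA =
    sym (trans (shift-at′ k A (suc s ℕ.+ d ℕ.+ k) (suc s ℕ.+ d) (ℕP.+-comm (suc s ℕ.+ d) k))
               (hA (suc s ℕ.+ d) (s≤s (ℕP.m≤n+m d s))))
  sylEntry-band (suc s) d k (suc c) A (s≤s le) hA =
    trans (cong (λ b → if b ∧ (c ∸ s ℕ.≤ᵇ d) then A (d ∸ (c ∸ s)) else + 0) (≤ᵇ-suc s c))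
          (sylEntry-band s d k c A le hA)

  sylEntry-fRow : ∀ f g m n → (∀ t → m ℕ.< t → coeff f t ≡ + 0) →
    ∀ r c → r ℕ.< n → c ℕ.< n ℕ.+ m → sylEntry f g m n r c ≡ sylMatrix m n (coeff f) (coeff g) r c
  sylEntry-fRow f g m n hf r c r<n c< =
    trans (if-T (r ℕ.<ᵇ n) (ℕP.<⇒<ᵇ r<n))
      (trans (sylEntry-band r m e c (coeff f) c≤ hf)
        (trans (cong (λ z → shift z (coeff f) ((r ℕ.+ m ℕ.+ e) ∸ c)) (sym (∸-eq n (suc r) e hn)))
          (trans (cong (λ z → shift (n ∸ suc r) (coeff f) (z ∸ suc c)) (sym NM))
            (sym (cong (λ φ → φ ((n ℕ.+ m) ∸ suc c)) (ifDec-yes (r ℕ.<? n) (shift (n ∸ suc r) (coeff f)) (shift (m ∸ suc (r ∸ n)) (coeff g)) r<n))))))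
    where
    e = proj₁ (split< r<n)
    hn = proj₂ (split< r<n)
    byRing : ∀ r e m → suc r ℕ.+ e ℕ.+ m ≡ suc (r ℕ.+ m ℕ.+ e)
    byRing = NS.solve-∀
    NM : n ℕ.+ m ≡ suc (r ℕ.+ m ℕ.+ e)
    NM = trans (cong (ℕ._+ m) hn) (byRing r e m)
    c≤ : c ℕ.≤ r ℕ.+ m ℕ.+ e
    c≤ = ℕP.≤-pred (subst (c ℕ.<_) NM c<)

  sylEntry-gRow : ∀ f g m n → (∀ t → n ℕ.< t → coeff g t ≡ + 0) →
    ∀ r c → n ℕ.≤ r → r ℕ.< n ℕ.+ m → c ℕ.< n ℕ.+ m → sylEntry f g m n r c ≡ sylMatrix m n (coeff f) (coeff g) r c
  sylEntry-gRow f g m n hg r c n≤r r< c< =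
    trans (if-¬T (r ℕ.<ᵇ n) (ℕP.≤⇒≯ n≤r ∘ ℕP.<ᵇ⇒< r n))
      (trans (sylEntry-band (r ∸ n) n e c (coeff g) c≤ hg)
        (trans (cong₂ (λ z u → shift z (coeff g) ((u ℕ.+ n ℕ.+ e) ∸ c)) (sym m∸) r∸n)
          (trans (cong (λ z → shift (m ∸ suc i) (coeff g) (z ∸ suc c)) (sym NM))
            (sym (trans (cong (λ φ → φ ((n ℕ.+ m) ∸ suc c)) (ifDec-no (r ℕ.<? n) (shift (n ∸ suc r) (coeff f)) (shift (m ∸ suc (r ∸ n)) (coeff g)) (ℕP.≤⇒≯ n≤r)))
                   (cong (λ z → shift (m ∸ suc z) (coeff g) ((n ℕ.+ m) ∸ suc c)) r∸n))))))
    where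
    i = proj₁ (split≤ n≤r)
    hr = proj₂ (split≤ n≤r)
    r∸n : r ∸ n ≡ i
    r∸n = ∸-eq r n i hr
    i<m : i ℕ.< m
    i<m = ℕP.+-cancelˡ-< n i m (subst (ℕ._< n ℕ.+ m) hr r<)
    e = proj₁ (split< i<m)
    hm = proj₂ (split< i<m)
    m∸ : m ∸ suc i ≡ e
    m∸ = ∸-eq m (suc i) e hm
    byRing : ∀ n i e → n ℕ.+ (suc i ℕ.+ e) ≡ suc (i ℕ.+ n ℕ.+ e)
    byRing = NS.solve-∀
    NM : n ℕ.+ m ≡ suc (i ℕ.+ n ℕ.+ e)
    NM = trans (cong (n ℕ.+_) hm) (byRing n i e)
    c≤ : c ℕ.≤ (r ∸ n) ℕ.+ n ℕ.+ e
    c≤ = subst (λ z → c ℕ.≤ z ℕ.+ n ℕ.+ e) (sym r∸n) (ℕP.≤-pred (subst (c ℕ.<_) NM c<))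

  sylEntry≡sylMatrix : ∀ f g m n → (∀ t → m ℕ.< t → coeff f t ≡ + 0) → (∀ t → n ℕ.< t → coeff g t ≡ + 0) →
    ∀ r c → r ℕ.< n ℕ.+ m → c ℕ.< n ℕ.+ m → sylEntry f g m n r c ≡ sylMatrix m n (coeff f) (coeff g) r c
  sylEntry≡sylMatrix f g m n hf hg r c r< c< = byCase (r ℕ.<? n)
    where
    byCase : Dec (r ℕ.< n) → sylEntry f g m n r c ≡ sylMatrix m n (coeff f) (coeff g) r c
    byCase (yes r<n) = sylEntry-fRow f g m n hf r c r<n c<
    byCase (no r≮n) = sylEntry-gRow f g m n hg r c (ℕP.≮⇒≥ r≮n) r< c<

  length≤suc-deg : ∀ (g : Poly) → length g ℕ.≤ suc (deg g)
  length≤suc-deg [] = z≤n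
  length≤suc-deg (a ∷ g) = ℕP.≤-refl

  det′-sylMatrix-linearProduct′ : ∀ cs g n m → m ≡ length cs → length g ℕ.≤ suc n →
    det′ (n ℕ.+ m) (sylMatrix m n (coeff (linearProduct cs)) (coeff g)) ≡ product (map (eval g) cs)
  det′-sylMatrix-linearProduct′ cs g n .(length cs) refl lg = det′-sylMatrix-linearProduct cs g n lg

  resultant-linearProduct : ∀ cs g → resultant (linearProduct cs) g ≡ product (map (eval g) cs)
  resultant-linearProduct cs g =
    trans (det≡det′ (deg g ℕ.+ deg f) (sylEntry f g (deg f) (deg g)))
      (trans (det′-cong (deg g ℕ.+ deg f) _ _
                (λ r c r< c< → sylEntry≡sylMatrix f g (deg f) (deg g) (coeff-beyondDeg f) (coeff-beyondDeg g) r c r< c<))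
        (det′-sylMatrix-linearProduct′ cs g (deg g) (deg f) (cong (_∸ 1) (length-linearProduct cs)) (length≤suc-deg g)))
    where
    f = linearProduct cs

module Legendre where

  open import Data.Nat as ℕ using (ℕ; zero; suc; z≤n; s≤s; _∸_; _+_; _*_; _^_; _/_; NonZero; _≤_; _<_; _!)
  open import Data.Nat.Properties
  open import Data.Nat.DivMod
  open import Data.Nat.Divisibility
  import Data.Nat.Tactic.RingSolver as NS
  open import Relation.Binary.PropositionalEquality
  open import Data.Product using (Σ-syntax; _,_; proj₁; proj₂)
  open import Data.List using (foldr; map; applyUpTo)
  open import Function using (_∘_)
  open import Data.Nat.Induction using (<-rec)
  open import Induction.WellFounded using (WfRec)

  natSum : ℕ → (ℕ → ℕ) → ℕ
  natSum zero h = 0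
  natSum (suc L) h = h 0 + natSum L (λ i → h (suc i))

  foldr-applyUpTo : ∀ L (f : ℕ → ℕ) (h : ℕ → ℕ) → foldr _+_ 0 (map h (applyUpTo f L)) ≡ natSum L (h ∘ f)
  foldr-applyUpTo zero f h = refl
  foldr-applyUpTo (suc L) f h = cong (h (f 0) +_) (foldr-applyUpTo L (f ∘ suc) h)

  natSum-cong : ∀ L {h h' : ℕ → ℕ} → (∀ i → h i ≡ h' i) → natSum L h ≡ natSum L h'
  natSum-cong zero e = refl
  natSum-cong (suc L) e = cong₂ _+_ (e 0) (natSum-cong L (e ∘ suc))

  natSum-split : ∀ L k h → natSum (L + k) h ≡ natSum L h + natSum k (λ i → h (L + i))
  natSum-split zero k h = refl
  natSum-split (suc L) k h = trans (cong (h 0 +_) (natSum-split L k (λ i → h (suc i)))) (sym (+-assoc (h 0) _ _))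

  natSum-zero : ∀ k h → (∀ i → h i ≡ 0) → natSum k h ≡ 0
  natSum-zero zero h e = refl
  natSum-zero (suc k) h e = cong₂ _+_ (e 0) (natSum-zero k (λ i → h (suc i)) (e ∘ suc))

  module _ (p : ℕ) .{{nz : NonZero p}} (1<p : 1 < p) where

    digitQuot : ℕ → ℕ → ℕ
    digitQuot b i = _/_ b (p ^ suc i) {{m^n≢0 p (suc i)}}

    legendre : ℕ → ℕ → ℕ
    legendre b L = natSum L (digitQuot b)

    α≡legendre : ∀ b → α p b ≡ legendre b b
    α≡legendre b = foldr-applyUpTo b (λ x → x) (digitQuot b)

    -- ⌊⌊b/p⌋ / p^(i+1)⌋ = ⌊b / p^(i+2)⌋ shifts Legendre's sum.
    legendre-suc : ∀ b L → legendre b (suc L) ≡ b / p + legendre (b / p) L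
    legendre-suc b L = cong₂ _+_ (/-congʳ {{m^n≢0 p 1}} {{nz}} (*-identityʳ p))
      (natSum-cong L (λ i → sym (m/n/o≡m/[n*o] b p (p ^ suc i) {{nz}} {{m^n≢0 p (suc i)}} {{m^n≢0 p (suc (suc i))}})))

    legendre-stable : ∀ b L k → b < p ^ suc L → legendre b (L + k) ≡ legendre b L
    legendre-stable b L k lt = trans (natSum-split L k (digitQuot b))
      (trans (cong (legendre b L +_) (natSum-zero k _ (λ i → m<n⇒m/n≡0 {{m^n≢0 p (suc (L + i))}}
                                    (<-≤-trans lt (^-monoʳ-≤ p (s≤s (m≤m+n L i)))))))
        (+-identityʳ _))

    -- x < p^x for p > 1, so the terms of α(b) with index ≥ b vanish.
    x<p^x : ∀ x → x < p ^ x
    x<p^x zero = s≤s z≤n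
    x<p^x (suc x) = begin-strict
        suc x
      ≤⟨ x<p^x x ⟩
        p ^ x
      <⟨ m<m*n (p ^ x) p 1<p ⟩
        p ^ x * p
      ≡⟨ *-comm (p ^ x) p ⟩
        p ^ suc x
      ∎
      where
      open ≤-Reasoning
      instance _ = m^n≢0 p x

    α-rec : ∀ b → 0 < b → α p b ≡ b / p + α p (b / p)
    α-rec (suc b') _ = trans (α≡legendre (suc b'))
      (trans (legendre-suc (suc b') b')
        (cong (q +_) (trans (cong (legendre q) (proj₂ sp)) (trans (legendre-stable q q (proj₁ sp) (<-trans (x<p^x q) (subst (p ^ q <_) ≡-p (m<m*n (p ^ q) p {{m^n≢0 p q}} 1<p)))) (sym (α≡legendre q))))))
      where
      instance _ = m^n≢0 p b'
      q = suc b' / p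
      q≤ : q ≤ b'
      q≤ = ≤-pred (m/n<m (suc b') p 1<p)
      sp : Σ[ k ∈ ℕ ] b' ≡ q + k
      sp = (b' ∸ q) , sym (m+[n∸m]≡n q≤)
      ≡-p : p ^ q * p ≡ p ^ suc q
      ≡-p = *-comm (p ^ q) p

    -- p^q · q! ∣ (pq)!: going from q to q+1 multiplies the left side by p(q+1),
    -- which divides (pq+1)(pq+2)⋯(pq+p).
    p^q*q!∣[p*q]! : ∀ q → p ^ q * q ! ∣ (p * q) !
    p^q*q!∣[p*q]! zero = subst (λ z → 1 ∣ z !) (sym (*-zeroʳ p)) ∣-refl
    p^q*q!∣[p*q]! (suc q) = subst (p ^ suc q * suc q ! ∣_) (cong _! (sym eqN)) step
      where
      p' = p ∸ 1
      hp : p ≡ suc p'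
      hp = sym (m+[n∸m]≡n {1} {p} (≤-trans (s≤s z≤n) 1<p))
      N = p * q
      eqN : p * suc q ≡ suc (N + p')
      eqN = trans (*-suc p q) (trans (cong (_+ N) hp) (cong suc (+-comm p' N)))
      r : p ^ suc q * suc q ! ≡ (p * suc q) * (p ^ q * q !)
      r = byRing p q (p ^ q) (q !)
        where
        byRing : ∀ p q a b → p * a * (b + q * b) ≡ p * (suc q) * (a * b)
        byRing = NS.solve-∀
      step : p ^ suc q * suc q ! ∣ suc (N + p') !
      step = subst (_∣ suc (N + p') !) (sym r)
        (*-pres-∣ (∣-reflexive eqN) (∣-trans (p^q*q!∣[p*q]! q) (m≤n⇒m!∣n! (m≤m+n N p'))))

    -- Legendre's bound p^α(b) ∣ b!, by strong induction on b:
    -- p^α(b) = p^q · p^α(q) ∣ p^q · q! ∣ (pq)! ∣ b!  for q = ⌊b/p⌋ < b.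
    p^α∣! : ∀ b → p ^ α p b ∣ b !
    p^α∣! = <-rec (λ b → p ^ α p b ∣ b !) step
      where
      step : ∀ b → WfRec _<_ (λ b → p ^ α p b ∣ b !) b → p ^ α p b ∣ b !
      step zero _ = ∣-refl
      step (suc b') ih = subst (_∣ suc b' !) (sym e)
          (∣-trans (*-monoʳ-∣ (p ^ q) (ih q<b))
            (∣-trans (p^q*q!∣[p*q]! q) (m≤n⇒m!∣n! (subst (_≤ suc b') (*-comm q p) (m/n*n≤m (suc b') p)))))
        where
        q = suc b' / p
        q<b : q < suc b'
        q<b = m/n<m (suc b') p 1<p
        e : p ^ α p (suc b') ≡ p ^ q * p ^ α p q
        e = trans (cong (p ^_) (α-rec (suc b') (s≤s z≤n))) (^-distribˡ-+-* p q (α p q))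

module IntegerPolynomials where

  open import Data.Nat as ℕ using (ℕ; zero; suc; _!)
  import Data.Nat.Properties as ℕP
  open import Data.Integer as ℤ using (ℤ; +_; -[1+_]; _+_; _*_; -_; _-_; _^_)
  import Data.Integer.Properties as ℤP
  open import Data.Integer.Tactic.RingSolver
  open import Data.Integer.Divisibility.Signed as SD using (divides)
  open import Relation.Binary.PropositionalEquality
  open import Data.List using ([]; _∷_; foldr; map; applyUpTo)
  open import Function using (_∘_)

  prod< : ℕ → (ℕ → ℤ) → ℤ
  prod< zero h = + 1
  prod< (suc n) h = h 0 * prod< n (λ i → h (suc i))

  prod-cong : ∀ n {h h' : ℕ → ℤ} → (∀ i → h i ≡ h' i) → prod< n h ≡ prod< n h'
  prod-cong zero e = refl
  prod-cong (suc n) e = cong₂ _*_ (e 0) (prod-cong n (e ∘ suc))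

  ^-*-distrib : ∀ a b k → (a * b) ^ k ≡ a ^ k * b ^ k
  ^-*-distrib a b zero = refl
  ^-*-distrib a b (suc k) = trans (cong ((a * b) *_) (^-*-distrib a b k)) (byRing a b (a ^ k) (b ^ k))
    where
    byRing : ∀ a b x y → a * b * (x * y) ≡ a * x * (b * y)
    byRing = solve-∀

  prod-^ : ∀ n h k → prod< n (λ i → h i ^ k) ≡ prod< n h ^ k
  prod-^ zero h k = sym (ℤP.^-zeroˡ k)
  prod-^ (suc n) h k = trans (cong (h 0 ^ k *_) (prod-^ n (h ∘ suc) k)) (sym (^-*-distrib (h 0) _ k))

  pos-^ : ∀ p k → + (p ℕ.^ k) ≡ (+ p) ^ k
  pos-^ p zero = refl
  pos-^ p (suc k) = trans (ℤP.pos-* p (p ℕ.^ k)) (cong (+ p *_) (pos-^ p k))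

  eval-⊕ : ∀ p q x → eval (p ⊕ q) x ≡ eval p x + eval q x
  eval-⊕ [] q x = sym (ℤP.+-identityˡ _)
  eval-⊕ (a ∷ p) [] x = sym (ℤP.+-identityʳ _)
  eval-⊕ (a ∷ p) (b ∷ q) x = trans (cong (λ z → a + b + x * z) (eval-⊕ p q x)) (byRing a b x (eval p x) (eval q x))
    where
    byRing : ∀ a b x u v → a + b + x * (u + v) ≡ a + x * u + (b + x * v)
    byRing = solve-∀

  eval-scale : ∀ a q x → eval (scale a q) x ≡ a * eval q x
  eval-scale a [] x = sym (ℤP.*-zeroʳ a)
  eval-scale a (b ∷ q) x = trans (cong (λ z → a * b + x * z) (eval-scale a q x)) (byRing a b x (eval q x))
    where
    byRing : ∀ a b x u → a * b + x * (a * u) ≡ a * (b + x * u)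
    byRing = solve-∀

  eval-⊗ : ∀ p q x → eval (p ⊗ q) x ≡ eval p x * eval q x
  eval-⊗ [] q x = sym (ℤP.*-zeroˡ (eval q x))
  eval-⊗ (a ∷ p) q x =
    trans (eval-⊕ (scale a q) (+ 0 ∷ (p ⊗ q)) x)
      (trans (cong₂ (λ u v → u + (+ 0 + x * v)) (eval-scale a q x) (eval-⊗ p q x))
        (byRing a x (eval p x) (eval q x)))
    where
    byRing : ∀ a x u v → a * v + (+ 0 + x * (u * v)) ≡ (a + x * u) * v
    byRing = solve-∀

  eval-lin : ∀ c x → eval (linP c) x ≡ x - c
  eval-lin c x = byRing c x
    where
    byRing : ∀ c x → - c + x * (+ 1 + x * + 0) ≡ x - c
    byRing = solve-∀

  eval-pow : ∀ q k x → eval (powP q k) x ≡ eval q x ^ k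
  eval-pow q zero x = byRing x
    where
    byRing : ∀ x → + 1 + x * + 0 ≡ + 1
    byRing = solve-∀
  eval-pow q (suc k) x = trans (eval-⊗ q (powP q k) x) (cong (eval q x *_) (eval-pow q k x))

  eval-prod : ∀ n (f : ℕ → ℕ) (q : ℕ → Poly) x →
    eval (foldr (λ j acc → q j ⊗ acc) (constP (+ 1)) (applyUpTo f n)) x ≡ prod< n (λ j → eval (q (f j)) x)
  eval-prod zero f q x = byRing x
    where
    byRing : ∀ x → + 1 + x * + 0 ≡ + 1
    byRing = solve-∀
  eval-prod (suc n) f q x = trans (eval-⊗ (q (f 0)) _ x) (cong (eval (q (f 0)) x *_) (eval-prod n (f ∘ suc) q x))

  prodZ-app : ∀ n (f : ℕ → ℕ) (h : ℕ → ℤ) → foldr _*_ (+ 1) (map h (applyUpTo f n)) ≡ prod< n (h ∘ f)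
  prodZ-app zero f h = refl
  prodZ-app (suc n) f h = cong (h (f 0) *_) (prodZ-app n (f ∘ suc) h)

  falling : ℤ → ℕ → ℤ
  falling x b = prod< b (λ j → x - + j)

  falling-suc-front : ∀ x b → falling x (suc b) ≡ x * falling (x - + 1) b
  falling-suc-front x b = cong₂ _*_ (ℤP.+-identityʳ x) (prod-cong b (λ j → trans (cong (λ z → x - z) (ℤP.pos-+ 1 j)) (byRing x (+ j))))
    where
    byRing : ∀ x j → x - (+ 1 + j) ≡ x - + 1 - j
    byRing = solve-∀

  falling-suc-back : ∀ x b → falling x (suc b) ≡ falling x b * (x - + b)
  falling-suc-back x zero = trans (ℤP.*-identityʳ _) (sym (ℤP.*-identityˡ _))
  falling-suc-back x (suc b) =
    trans (falling-suc-front x (suc b))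
      (trans (cong (x *_) (falling-suc-back (x - + 1) b))
        (trans (byRing x (falling (x - + 1) b) (+ b))
          (cong₂ (λ u v → u * (x - v)) (sym (falling-suc-front x b)) (sym (ℤP.pos-+ 1 b)))))
    where
    byRing : ∀ x q b → x * (q * (x - + 1 - b)) ≡ x * q * (x - (+ 1 + b))
    byRing = solve-∀

  falling-pascal : ∀ x b → falling (x + + 1) (suc b) ≡ falling x (suc b) + + (suc b) * falling x b
  falling-pascal x b =
    trans (falling-suc-front (x + + 1) b)
      (trans (cong (λ z → (x + + 1) * falling z b) (byRing₀ x))
        (trans (byRing x (falling x b) (+ b))
          (cong₂ (λ u v → u + v * falling x b) (sym (falling-suc-back x b)) (sym (ℤP.pos-+ 1 b)))))
    where
    byRing₀ : ∀ x → x + + 1 - + 1 ≡ x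
    byRing₀ = solve-∀
    byRing : ∀ x q b → (x + + 1) * q ≡ q * (x - b) + (+ 1 + b) * q
    byRing = solve-∀

  ℤ-induction : (P : ℤ → Set) → P (+ 0) → (∀ x → P x → P (x + + 1)) → (∀ x → P (x + + 1) → P x) → ∀ x → P x
  ℤ-induction P p0 up dn (+ zero) = p0
  ℤ-induction P p0 up dn (+ suc k) = subst P (cong +_ (ℕP.+-comm k 1)) (up (+ k) (ℤ-induction P p0 up dn (+ k)))
  ℤ-induction P p0 up dn -[1+ zero ] = dn -[1+ zero ] p0
  ℤ-induction P p0 up dn -[1+ suc k ] = dn -[1+ suc k ] (ℤ-induction P p0 up dn -[1+ k ])

  !∣falling : ∀ b x → (+ (b !)) SD.∣ falling x b
  !∣falling zero x = divides (falling x 0) (sym (ℤP.*-identityʳ _))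
  !∣falling (suc b) = ℤ-induction (λ x → (+ (suc b !)) SD.∣ falling x (suc b)) p0 up dn
    where
    k∣ : ∀ x → (+ (suc b !)) SD.∣ + (suc b) * falling x b
    k∣ x = subst (SD._∣ + (suc b) * falling x b) (sym (ℤP.pos-* (suc b) (b !))) (SD.*-monoʳ-∣ (+ suc b) (!∣falling b x))
    p0 : (+ (suc b !)) SD.∣ falling (+ 0) (suc b)
    p0 = divides (+ 0) (trans (falling-suc-front (+ 0) b) (trans (ℤP.*-zeroˡ (falling (+ 0 - + 1) b)) (sym (ℤP.*-zeroˡ (+ (suc b !))))))
    up : ∀ x → (+ (suc b !)) SD.∣ falling x (suc b) → (+ (suc b !)) SD.∣ falling (x + + 1) (suc b)
    up x h = subst ((+ (suc b !)) SD.∣_) (sym (falling-pascal x b)) (SD.∣m∣n⇒∣m+n h (k∣ x))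
    dn : ∀ x → (+ (suc b !)) SD.∣ falling (x + + 1) (suc b) → (+ (suc b !)) SD.∣ falling x (suc b)
    dn x h = SD.∣m+n∣n⇒∣m (subst ((+ (suc b !)) SD.∣_) (falling-pascal x b) h) (k∣ x)

module Valuations where

  open import Data.Nat as ℕ using (ℕ; zero; suc; z≤n; s≤s; NonZero; _!)
  import Data.Nat.Properties as ℕP
  import Data.Nat.Divisibility as ND
  open import Data.Integer as ℤ using (ℤ; +_; _+_; _*_; -_; _-_; _^_)
  import Data.Integer.Properties as ℤP
  open import Data.Integer.Tactic.RingSolver
  import Data.Integer.Divisibility as UD
  open import Data.Integer.Divisibility.Signed as SD using (divides)
  open import Data.Integer.GCD using (gcd; gcd-greatest; gcd[i,j]∣j)
  open import Relation.Binary.PropositionalEquality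
  open import Relation.Nullary using (¬_)
  open import Data.Product using (Σ-syntax; _,_)
  open import Data.List using (List; []; _∷_; foldr; map; upTo)
  import Data.List.Properties as LP
  open import Function using (_∘_)
  open Legendre using (p^α∣!)
  open IntegerPolynomials
  open LinearProductResultant using (linearProduct; product)
  open Resultant using (resultant-linearProduct)

  -- y = p^K (1 + p W): the shape of a number of valuation exactly K.
  ValForm : ℕ → ℕ → ℤ → Set
  ValForm p K y = Σ[ W ∈ ℤ ] y ≡ + (p ℕ.^ K) * (+ 1 + + p * W)

  -- p^K divides p^K (1 + p W), and p^(K+1) does not since p ∤ 1 + p W for p > 1.
  valForm⇒IsVal : ∀ p .{{_ : NonZero p}} → 1 ℕ.< p → ∀ K y → ValForm p K y → IsVal p y K
  valForm⇒IsVal p 1<p K y (W , refl) = d1 , nd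
    where
    z = + 1 + + p * W
    d1 : (+ (p ℕ.^ K)) UD.∣ (+ (p ℕ.^ K) * z)
    d1 = SD.∣⇒∣ᵤ {+ (p ℕ.^ K)} {+ (p ℕ.^ K) * z} (divides z (ℤP.*-comm (+ (p ℕ.^ K)) z))
    nd : ¬ ((+ (p ℕ.^ suc K)) UD.∣ (+ (p ℕ.^ K) * z))
    nd h = ℕP.<-irrefl (sym p≡1) 1<p
      where
      e : + (p ℕ.^ suc K) ≡ + (p ℕ.^ K) * + p
      e = trans (ℤP.pos-* p (p ℕ.^ K)) (ℤP.*-comm (+ p) _)
      h' : (+ (p ℕ.^ K) * + p) SD.∣ (+ (p ℕ.^ K) * z)
      h' = subst (SD._∣ (+ (p ℕ.^ K) * z)) e (SD.∣ᵤ⇒∣ h)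
      h2 : (+ p) SD.∣ z
      h2 = SD.*-cancelˡ-∣ (+ (p ℕ.^ K)) {{ℕP.m^n≢0 p K}} h'
      h3 : (+ p) SD.∣ (+ 1)
      h3 = SD.∣m+n∣n⇒∣m h2 (divides W (ℤP.*-comm (+ p) W))
      p≡1 : p ≡ 1
      p≡1 = ND.∣1⇒≡1 (SD.∣⇒∣ᵤ h3)

  valForm-prod : ∀ p s n (h : ℕ → ℤ) → (∀ j → ValForm p s (h j)) → ValForm p (s ℕ.* n) (prod< n h)
  valForm-prod p s zero h hv = + 0 , trans (byRing (+ p)) (cong (λ k → + (p ℕ.^ k) * (+ 1 + + p * + 0)) (sym (ℕP.*-zeroʳ s)))
    where
    byRing : ∀ p → + 1 ≡ + 1 * (+ 1 + p * + 0)
    byRing = solve-∀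
  valForm-prod p s (suc n) h hv with hv 0 | valForm-prod p s n (h ∘ suc) (hv ∘ suc)
  ... | W1 , e1 | W2 , e2 = (W1 + W2 + + p * W1 * W2) ,
    trans (cong₂ _*_ e1 e2)
      (trans (byRing (+ (p ℕ.^ s)) (+ (p ℕ.^ (s ℕ.* n))) (+ p) W1 W2)
        (cong (λ u → u * (+ 1 + + p * (W1 + W2 + + p * W1 * W2))) (sym pe)))
    where
    byRing : ∀ A B p u v → A * (+ 1 + p * u) * (B * (+ 1 + p * v)) ≡ A * B * (+ 1 + p * (u + v + p * u * v))
    byRing = solve-∀
    pe : + (p ℕ.^ (s ℕ.* suc n)) ≡ + (p ℕ.^ s) * + (p ℕ.^ (s ℕ.* n))
    pe = trans (cong (λ k → + (p ℕ.^ k)) (ℕP.*-suc s n))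
           (trans (cong +_ (ℕP.^-distribˡ-+-* p s (s ℕ.* n))) (ℤP.pos-* (p ℕ.^ s) _))

  p∣p! : ∀ p → 0 ℕ.< p → (+ p) SD.∣ (+ (p !))
  p∣p! (suc p') _ = divides (+ (p' !)) (trans (ℤP.pos-* (suc p') (p' !)) (ℤP.*-comm (+ suc p') _))

  -- g(x) = p^s + (x(x-1)⋯(x-p+1))^(s+1) and p! ∣ x(x-1)⋯(x-p+1), so g(x) = p^s (1 + p w).
  gPoly-valForm : ∀ p s x → 0 ℕ.< p → ValForm p s (eval (gPoly p s) x)
  gPoly-valForm p s x 0<p with SD.∣-trans (p∣p! p 0<p) (!∣falling p x)
  ... | divides w eqw = (w ^ suc s) , (begin
      eval (gPoly p s) x
    ≡⟨ eval-⊕ (constP (+ (p ℕ.^ s))) (prodP p (λ i → powP (linP (+ i)) (suc s))) x ⟩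
      (+ (p ℕ.^ s) + x * + 0) + eval (prodP p (λ i → powP (linP (+ i)) (suc s))) x
    ≡⟨ cong₂ _+_ (constTerm (+ (p ℕ.^ s)) x) (eval-prod p (λ j → j) (λ i → powP (linP (+ i)) (suc s)) x) ⟩
      + (p ℕ.^ s) + prod< p (λ j → eval (powP (linP (+ j)) (suc s)) x)
    ≡⟨ cong (_+_ (+ (p ℕ.^ s))) (prod-cong p (λ j → trans (eval-pow (linP (+ j)) (suc s) x) (cong (_^ suc s) (eval-lin (+ j) x)))) ⟩
      + (p ℕ.^ s) + prod< p (λ j → (x - + j) ^ suc s)
    ≡⟨ cong (_+_ (+ (p ℕ.^ s))) (prod-^ p (λ j → x - + j) (suc s)) ⟩
      + (p ℕ.^ s) + falling x p ^ suc s
    ≡⟨ cong (λ q → + (p ℕ.^ s) + q ^ suc s) eqw ⟩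
      + (p ℕ.^ s) + (w * + p) ^ suc s
    ≡⟨ cong (λ q → + (p ℕ.^ s) + (w * + p) * q) (^-*-distrib w (+ p) s) ⟩
      + (p ℕ.^ s) + (w * + p) * (w ^ s * (+ p) ^ s)
    ≡⟨ cong (λ P → P + (w * + p) * (w ^ s * (+ p) ^ s)) (pos-^ p s) ⟩
      (+ p) ^ s + (w * + p) * (w ^ s * (+ p) ^ s)
    ≡⟨ byRing ((+ p) ^ s) w (+ p) (w ^ s) ⟩
      (+ p) ^ s * (+ 1 + + p * (w * w ^ s))
    ≡⟨ cong (λ P → P * (+ 1 + + p * (w * w ^ s))) (sym (pos-^ p s)) ⟩
      + (p ℕ.^ s) * (+ 1 + + p * (w ^ suc s))
    ∎)
    where
    open ≡-Reasoning
    constTerm : ∀ a x → a + x * + 0 ≡ a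
    constTerm = solve-∀
    byRing : ∀ P w p A → P + (w * p) * (A * P) ≡ P * (+ 1 + p * (w * A))
    byRing = solve-∀

  eval-fPoly : ∀ b x → eval (fPoly b) x ≡ falling x b
  eval-fPoly b x = trans (eval-prod b (λ j → j) (λ j → linP (+ j)) x) (prod-cong b (λ j → eval-lin (+ j) x))

  fPoly≡linearProduct : ∀ (xs : List ℕ) → foldr (λ j acc → linP (+ j) ⊗ acc) (constP (+ 1)) xs ≡ linearProduct (map +_ xs)
  fPoly≡linearProduct [] = refl
  fPoly≡linearProduct (x ∷ xs) = cong (linP (+ x) ⊗_) (fPoly≡linearProduct xs)

  resultant-fPoly : ∀ b g → resultant (fPoly b) g ≡ prod< b (λ j → eval g (+ j))
  resultant-fPoly b g =
    trans (cong (λ f → resultant f g) (fPoly≡linearProduct (upTo b)))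
      (trans (resultant-linearProduct (map +_ (upTo b)) g)
        (trans (cong product (sym (LP.map-∘ (upTo b))))
          (prodZ-app b (λ j → j) (λ j → eval g (+ j)))))

  ^-mono-∣ : ∀ p s k → s ℕ.≤ k → (p ℕ.^ s) ND.∣ (p ℕ.^ k)
  ^-mono-∣ p s k le = subst (λ t → (p ℕ.^ s) ND.∣ (p ℕ.^ t)) (ℕP.m+[n∸m]≡n le)
    (subst ((p ℕ.^ s) ND.∣_) (sym (ℕP.^-distribˡ-+-* p s (k ℕ.∸ s))) (ND.m∣m*n _))

  IsVal-gcd : ∀ p a b K → (+ (p ℕ.^ K)) UD.∣ a → IsVal p b K → IsVal p (gcd a b) K
  IsVal-gcd p a b K pᴷ∣a (pᴷ∣b , p¹⁺ᴷ∤b) =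
    gcd-greatest {a} {b} {+ (p ℕ.^ K)} pᴷ∣a pᴷ∣b , λ h → p¹⁺ᴷ∤b (ND.∣-trans h (gcd[i,j]∣j a b))

  -- f(n) = n(n-1)⋯(n-b+1) is divisible by b!, hence by p^α(b) and by p^s
  p^s∣eval-fPoly : ∀ p .{{_ : NonZero p}} → 1 ℕ.< p → ∀ s b → s ℕ.≤ α p b → ∀ n →
    (+ (p ℕ.^ s)) UD.∣ eval (fPoly b) n
  p^s∣eval-fPoly p 1<p s b s≤α n =
    SD.∣⇒∣ᵤ (subst ((+ (p ℕ.^ s)) SD.∣_) (sym (eval-fPoly b n)) (SD.∣-trans (SD.∣ᵤ⇒∣ pˢ∣b!) (!∣falling b n)))
    where
    pˢ∣b! : (p ℕ.^ s) ND.∣ (b !)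
    pˢ∣b! = ND.∣-trans (^-mono-∣ p s (α p b) s≤α) (p^α∣! p 1<p b)

open import Data.Nat using (ℕ; NonZero; _*_; _<_; nonTrivial⇒n>1; z≤n; s≤s)
open import Data.Nat.Properties using (<-trans)
open import Data.Nat.Primality using (Prime; prime⇒nonTrivial)
open import Data.Integer using (ℤ; +_)
open import Data.Integer.GCD using (gcd)
open import Data.Product using (_×_; _,_)
open import Relation.Binary.PropositionalEquality using (subst; sym)
open Valuations

mainTheorem5 : (p : ℕ) .{{_ : NonZero p}} → Prime p → (s b : ℕ) → IsBeta p s b →
    ((n : ℤ) → IsVal p (gcd (eval (fPoly b) n) (eval (gPoly p s) n)) s)
    × IsVal p (resultant (fPoly b) (gPoly p s)) (s * b)
mainTheorem5 p p-prime s b (s≤α , _) = gcdValuation , resultantValuation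
  where
  1<p : 1 < p
  1<p = nonTrivial⇒n>1 p {{prime⇒nonTrivial p-prime}}
  0<p : 0 < p
  0<p = <-trans (s≤s z≤n) 1<p
  gValuation : ∀ n → IsVal p (eval (gPoly p s) n) s
  gValuation n = valForm⇒IsVal p 1<p s _ (gPoly-valForm p s n 0<p)
  gcdValuation : (n : ℤ) → IsVal p (gcd (eval (fPoly b) n) (eval (gPoly p s) n)) s
  gcdValuation n = IsVal-gcd p (eval (fPoly b) n) (eval (gPoly p s) n) s (p^s∣eval-fPoly p 1<p s b s≤α n) (gValuation n)
  -- res(f, g) = g(0) g(1) ⋯ g(b-1), a product of b numbers of the form p^s (1 + p·w)
  resultantValuation : IsVal p (resultant (fPoly b) (gPoly p s)) (s * b)
  resultantValuation = subst (λ y → IsVal p y (s * b)) (sym (resultant-fPoly b (gPoly p s)))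
    (valForm⇒IsVal p 1<p (s * b) _ (valForm-prod p s b _ (λ j → gPoly-valForm p s (+ j) 0<p)))
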